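{- Let $a,b,c,d\geq0$ be integers with $\min\{b,c\}=3$ and $\max\{a,d\}\leq 2$, and let $m\geq 4$ satisfy $2^{m-2}\geq(\max\{b,c\}-1)m^2$. Then \[\mathrm{forb}(m,3,F(a,b,c,d))=\mathrm{forb}(m,3,3\cdot I_2)=\mathrm{forb}(m,3,3\cdot K_2)-1.\]
   Context: An $s$-matrix is a matrix with entries in $\{0,1,\dots,s-1\}$; it is simple if it has no repeated columns. $|A|$ is the number of columns of $A$. $F\prec A$ means some submatrix of $A$ is a row and column permutation of $F$. $\mathrm{Avoid}(m,s,F)$ is the set of $m$-rowed simple $s$-matrices $A$ with $F\not\prec A$, and $\mathrm{forb}(m,s,F)=\max\{|A|: A\in\mathrm{Avoid}(m,s,F)\}$. $F(a,b,c,d)$ is the $2$-rowed $(0,1)$-matrix with $a$ columns $\binom00$, $b$ columns $\binom10$, $c$ columns $\binom01$ and $d$ columns $\binom11$ (top entry first). $K_2$ is the $2\times4$ matrix of all $(0,1)$-columns, $I_2$ the $2\times2$ identity matrix, $p\cdot F$ the concatenation of $p$ copies of $F$. -}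

module Defs where

open import Data.Nat using (ℕ; zero; suc; _≤_)
open import Data.Fin using (Fin; zero; suc)
open import Data.Vec using (Vec; []; _∷_)
import Data.Vec as Vec
open import Data.List using (List; length; replicate; _++_; concat)
import Data.List as List
open import Data.List.Relation.Unary.Unique.Propositional using (Unique)
open import Data.Product using (Σ; ∃; _×_; _,_)
open import Function.Definitions using (Injective)
open import Relation.Binary.PropositionalEquality using (_≡_)
open import Relation.Nullary using (¬_)

-- An m-rowed s-matrix is represented as the list of its columns;
-- each column is a vector of m entries in {0,…,s-1} = Fin s.
Matrix : ℕ → ℕ → Set
Matrix m s = List (Vec (Fin s) m)

∣_∣ᶜ : ∀ {m s} → Matrix m s → ℕ
∣ A ∣ᶜ = length A

entry : ∀ {m s} (A : Matrix m s) → Fin m → Fin (length A) → Fin s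
entry A i j = Vec.lookup (List.lookup A j) i

Simple : ∀ {m s} → Matrix m s → Set
Simple A = Unique A

-- F ≺ A : some submatrix of A is a row and column permutation of F,
-- i.e. there are injective maps of F's rows into A's rows and of F's
-- columns into A's columns under which the entries agree.
_≺_ : ∀ {k m s} → Matrix k s → Matrix m s → Set
_≺_ {k} {m} F A =
  Σ (Fin k → Fin m) λ ρ → Σ (Fin (length F) → Fin (length A)) λ σ →
    Injective _≡_ _≡_ ρ × Injective _≡_ _≡_ σ ×
    (∀ i j → entry A (ρ i) (σ j) ≡ entry F i j)

Avoid : ∀ {k} (m s : ℕ) → Matrix k s → Matrix m s → Set
Avoid m s F A = Simple A × ¬ (F ≺ A)

IsForb : ∀ {k} (m s : ℕ) → Matrix k s → ℕ → Set
IsForb m s F n =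
  (Σ (Matrix m s) λ A → Avoid m s F A × ∣ A ∣ᶜ ≡ n) ×
  (∀ (A : Matrix m s) → Avoid m s F A → ∣ A ∣ᶜ ≤ n)

c00 c10 c01 c11 : Vec (Fin 3) 2
c00 = zero ∷ zero ∷ []
c10 = suc zero ∷ zero ∷ []
c01 = zero ∷ suc zero ∷ []
c11 = suc zero ∷ suc zero ∷ []

Fabcd : ℕ → ℕ → ℕ → ℕ → Matrix 2 3
Fabcd a b c d = replicate a c00 ++ replicate b c10 ++ replicate c c01 ++ replicate d c11

I₂ K₂ : Matrix 2 3
I₂ = c10 List.∷ c01 List.∷ List.[]
K₂ = c00 List.∷ c10 List.∷ c01 List.∷ c11 List.∷ List.[]

_·_ : ∀ {k s} → ℕ → Matrix k s → Matrix k s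
p · F = concat (replicate p F)

-- Avoiding 3·K₂, resp. F(a,b,c,d), means that for every pair of rows r < s one of the
-- patterns 00, 10, 01, 11 (or, for F, the pattern "10 or 01", called pI₂) occurs only
-- a bounded number of times in rows r, s.  Fixing such a pattern for every pair, the
-- standard induction on the top row bounds a simple matrix by g m plus the total
-- number of occurrences, which gives forb(m,3,3·K₂) ≤ g m + 2·C(m,2).  For F(a,b,c,d)
-- the bound improves by one.  If some pair needs pI₂, its up to 2β occurrences
-- (β = max(b,c) − 1) are outweighed by a saving of 2^(m−2) ≥ β·m² in the induction,
-- because the tails that occur under both 0 and 1 then lie in a box of half the size.
-- Otherwise each pair uses 10 or 01 exactly twice, orienting it: a directed 3-cycle
-- yields a column of that box with positive weight, saving 1; in a transitive
-- tournament a column with 0 at the source and 1 at the sink has weight at least 2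
-- unless all its other entries are 2, so either some column of weight 2 saves 1 or
-- that pair occurs only once.  Matching lower bounds come from explicit recursive
-- constructions, and avoiding 3·I₂ implies avoiding F(a,b,c,d) since b, c ≥ 3.

module Submission where

open import Defs
open import Data.Nat using (ℕ; suc; _≤_; _≥_; _∸_; _*_; _^_; _⊔_; _⊓_)
open import Data.Product using (∃; _×_)
open import Relation.Binary.PropositionalEquality using (_≡_)

open import Data.Bool using (true; false; if_then_else_)
open import Data.Empty using (⊥; ⊥-elim)
open import Data.Fin.Base as Fin using (Fin; zero; suc; punchIn; punchOut)
open import Data.Fin.Patterns using (0F; 1F; 2F)
import Data.Fin.Properties as Finₚ
open import Data.List using (List; []; _∷_; _++_; length; map; filter; allFin; cartesianProductWith)
import Data.List as List
open import Data.List.Membership.Propositional using (_∈_; find)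
open import Data.List.Membership.Propositional.Properties
  using (∈-∃++; ∈-++⁻; ∈-++⁺ˡ; ∈-++⁺ʳ; ∈-filter⁻; ∈-map⁺; ∈-map⁻; ∈-allFin; ∈-cartesianProductWith⁺)
import Data.List.Membership.DecPropositional as DecMembership
open import Data.List.Properties using (map-++; length-++; length-map; length-tabulate; ++-assoc)
open import Data.List.Relation.Binary.Disjoint.Propositional using (Disjoint)
open import Data.List.Relation.Unary.All using (All; []; _∷_)
import Data.List.Relation.Unary.All as All
open import Data.List.Relation.Unary.AllPairs using ([]; _∷_)
open import Data.List.Relation.Unary.Any using (here; there; any?)
import Data.List.Relation.Unary.Any as Any
open import Data.List.Relation.Unary.Unique.Propositional using (Unique)
import Data.List.Relation.Unary.Unique.Propositional.Properties as Unique
open import Data.Nat using (zero; _+_; _<_; z≤n; s≤s; z<s; s<s; _≤?_; _≟_)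
open import Data.Nat.Combinatorics using (_C_; nC1≡n; nCk+nC[k+1]≡[n+1]C[k+1])
open import Data.Nat.ListAction using (sum)
open import Data.Nat.ListAction.Properties using (sum-++)
open import Data.Nat.Properties
open import Algebra.Properties.CommutativeMonoid.Sum +-0-commutativeMonoid
  using (sum-remove; sum-cong-≗) renaming (sum to ∑ᵥ)
open import Algebra.Properties.CommutativeSemigroup +-commutativeSemigroup
  using (interchange; x∙yz≈y∙xz; xy∙z≈xz∙y)
open import Data.Nat.Tactic.RingSolver using (solve-∀)
open import Data.Product using (Σ; _,_; proj₁; proj₂)
import Data.Product as Prod
open import Data.Sum using (_⊎_; inj₁; inj₂; [_,_]′)
import Data.Sum as Sum
open import Data.Vec using (Vec; []; _∷_; lookup; tabulate; replicate)
import Data.Vec.Properties as Vec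
open import Function using (_∘_)
open import Function.Definitions using (Injective)
open import Relation.Binary.Definitions using (DecidableEquality; tri<; tri≈; tri>)
open import Relation.Binary.PropositionalEquality
  using (refl; sym; trans; cong; cong₂; subst; subst₂; _≢_; module ≡-Reasoning)
open import Relation.Nullary using (¬_; Dec; yes; no; does; ¬?; _×-dec_)
open import Relation.Unary using (Decidable)

private variable A B : Set

∑ : List A → (A → ℕ) → ℕ
∑ xs f = sum (map f xs)

syntax ∑ xs (λ x → e) = ∑[ x ∈ xs ] e

∑-++ : ∀ (xs ys : List A) f → ∑ (xs ++ ys) f ≡ ∑ xs f + ∑ ys f
∑-++ xs ys f = trans (cong sum (map-++ f xs ys)) (sum-++ (map f xs) (map f ys))

∑-map : ∀ (g : B → A) xs f → ∑ (map g xs) f ≡ ∑ xs (f ∘ g)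
∑-map g [] f = refl
∑-map g (x ∷ xs) f = cong (f (g x) +_) (∑-map g xs f)

∑-distrib-+ : ∀ (xs : List A) f g → ∑[ x ∈ xs ] (f x + g x) ≡ ∑ xs f + ∑ xs g
∑-distrib-+ [] f g = refl
∑-distrib-+ (x ∷ xs) f g rewrite ∑-distrib-+ xs f g = interchange (f x) (g x) (∑ xs f) (∑ xs g)

∑-cong : ∀ (xs : List A) {f g} → (∀ {x} → x ∈ xs → f x ≡ g x) → ∑ xs f ≡ ∑ xs g
∑-cong [] eq = refl
∑-cong (x ∷ xs) eq = cong₂ _+_ (eq (here refl)) (∑-cong xs (eq ∘ there))

∑-mono : ∀ (xs : List A) {f g} → (∀ {x} → x ∈ xs → f x ≤ g x) → ∑ xs f ≤ ∑ xs g
∑-mono [] le = z≤n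
∑-mono (x ∷ xs) le = +-mono-≤ (le (here refl)) (∑-mono xs (le ∘ there))

∑-mono-< : ∀ {xs : List A} {f g y} → (∀ {x} → x ∈ xs → f x ≤ g x) → y ∈ xs → f y < g y →
           ∑ xs f < ∑ xs g
∑-mono-< {xs = x ∷ xs} le (here refl) lt = +-mono-<-≤ lt (∑-mono xs (le ∘ there))
∑-mono-< {xs = x ∷ xs} le (there y∈xs) lt = +-mono-≤-< (le (here refl)) (∑-mono-< (le ∘ there) y∈xs lt)

∑-const : ∀ (xs : List A) c → ∑[ x ∈ xs ] c ≡ length xs * c
∑-const [] c = refl
∑-const (x ∷ xs) c = cong (c +_) (∑-const xs c)

length≡∑1 : ∀ (xs : List A) → length xs ≡ ∑[ x ∈ xs ] 1
length≡∑1 xs = sym (trans (∑-const xs 1) (*-identityʳ _))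

∑-zero : ∀ (xs : List A) {f} → (∀ {x} → x ∈ xs → f x ≡ 0) → ∑ xs f ≡ 0
∑-zero [] eq = refl
∑-zero (x ∷ xs) eq = cong₂ _+_ (eq (here refl)) (∑-zero xs (eq ∘ there))

∑≡0⇒ : ∀ {xs : List A} {f x} → ∑ xs f ≡ 0 → x ∈ xs → f x ≡ 0
∑≡0⇒ {xs = y ∷ xs} {f} eq (here refl) = m+n≡0⇒m≡0 (f y) eq
∑≡0⇒ {xs = y ∷ xs} {f} eq (there x∈xs) = ∑≡0⇒ (m+n≡0⇒n≡0 (f y) eq) x∈xs

∑-comm : ∀ (xs : List A) (ys : List B) (f : A → B → ℕ) →
         ∑[ x ∈ xs ] ∑[ y ∈ ys ] f x y ≡ ∑[ y ∈ ys ] ∑[ x ∈ xs ] f x y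
∑-comm [] ys f = sym (∑-zero ys (λ _ → refl))
∑-comm (x ∷ xs) ys f = begin
  ∑ ys (f x) + ∑[ x′ ∈ xs ] ∑[ y ∈ ys ] f x′ y   ≡⟨ cong (∑ ys (f x) +_) (∑-comm xs ys f) ⟩
  ∑ ys (f x) + ∑[ y ∈ ys ] ∑[ x′ ∈ xs ] f x′ y   ≡⟨ ∑-distrib-+ ys (f x) (λ y → ∑[ x′ ∈ xs ] f x′ y) ⟨
  ∑[ y ∈ ys ] (f x y + ∑[ x′ ∈ xs ] f x′ y)      ∎
  where open ≡-Reasoning

private
  ∈-delete : ∀ {x y : A} l r → x ∈ l ++ y ∷ r → x ≢ y → x ∈ l ++ r
  ∈-delete {x} l r x∈ x≢y with ∈-++⁻ l x∈
  ... | inj₁ x∈l = ∈-++⁺ˡ x∈l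
  ... | inj₂ (here x≡y) = ⊥-elim (x≢y x≡y)
  ... | inj₂ (there x∈r) = ∈-++⁺ʳ l x∈r

∑-⊆ : ∀ {ys xs : List A} f → Unique ys → (∀ {y} → y ∈ ys → y ∈ xs) → ∑ ys f ≤ ∑ xs f
∑-⊆ {ys = []} f _ _ = z≤n
∑-⊆ {ys = y ∷ ys} f (y∉ys ∷ unique) ys⊆xs with ∈-∃++ (ys⊆xs (here refl))
... | l , r , refl = begin
  f y + ∑ ys f               ≤⟨ +-monoʳ-≤ (f y) (∑-⊆ f unique ys⊆l++r) ⟩
  f y + ∑ (l ++ r) f         ≡⟨ cong (f y +_) (∑-++ l r f) ⟩
  f y + (∑ l f + ∑ r f)      ≡⟨ x∙yz≈y∙xz (f y) (∑ l f) (∑ r f) ⟩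
  ∑ l f + (f y + ∑ r f)      ≡⟨ ∑-++ l (y ∷ r) f ⟨
  ∑ (l ++ y ∷ r) f           ∎
  where
  open ≤-Reasoning
  ys⊆l++r : ∀ {z} → z ∈ ys → z ∈ l ++ r
  ys⊆l++r z∈ys = ∈-delete l r (ys⊆xs (there z∈ys)) (λ z≡y → All.lookup y∉ys z∈ys (sym z≡y))

length-⊆ : ∀ {ys xs : List A} → Unique ys → (∀ {y} → y ∈ ys → y ∈ xs) → length ys ≤ length xs
length-⊆ {ys = ys} {xs = xs} unique ys⊆xs =
  subst₂ _≤_ (sym (length≡∑1 ys)) (sym (length≡∑1 xs)) (∑-⊆ (λ _ → 1) unique ys⊆xs)

∑-pair : ∀ {xs : List A} {x y} f → Unique xs → x ∈ xs → y ∈ xs → x ≢ y → f x + f y ≤ ∑ xs f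
∑-pair {xs = xs} {x} {y} f unique x∈xs y∈xs x≢y =
  subst (_≤ ∑ xs f) (cong (f x +_) (+-identityʳ (f y)))
    (∑-⊆ f ((x≢y ∷ []) ∷ [] ∷ []) λ { (here refl) → x∈xs ; (there (here refl)) → y∈xs })

∑-member : ∀ {xs : List A} {x} f → x ∈ xs → f x ≤ ∑ xs f
∑-member f (here refl) = m≤m+n _ _
∑-member {xs = y ∷ xs} f (there x∈xs) = ≤-trans (∑-member f x∈xs) (m≤n+m _ (f y))

∑-filter : ∀ {P : A → Set} (P? : Decidable P) (xs : List A) f →
           ∑ xs f ≡ ∑ (filter P? xs) f + ∑ (filter (¬? ∘ P?) xs) f
∑-filter P? [] f = refl
∑-filter P? (x ∷ xs) f with does (P? x)
... | true  = trans (cong (f x +_) (∑-filter P? xs f)) (sym (+-assoc (f x) _ _))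
... | false = trans (cong (f x +_) (∑-filter P? xs f)) (x∙yz≈y∙xz (f x) (∑ (filter P? xs) f) _)

length-filter : ∀ {P : A → Set} (P? : Decidable P) (xs : List A) →
                length xs ≡ length (filter P? xs) + length (filter (¬? ∘ P?) xs)
length-filter P? xs = trans (length≡∑1 xs)
  (trans (∑-filter P? xs (λ _ → 1)) (sym (cong₂ _+_ (length≡∑1 (filter P? xs)) (length≡∑1 (filter (¬? ∘ P?) xs)))))

zeros : (A → ℕ) → List A → List A
zeros f = filter (λ x → f x ≟ 0)

length≤zeros+∑ : ∀ (xs : List A) f → length xs ≤ length (zeros f xs) + ∑ xs f
length≤zeros+∑ [] f = z≤n
length≤zeros+∑ (x ∷ xs) f with f x
... | zero  = s≤s (length≤zeros+∑ xs f)
... | suc k = begin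
  suc (length xs)                   ≤⟨ s≤s (length≤zeros+∑ xs f) ⟩
  suc (length (zeros f xs) + ∑ xs f) ≡⟨ +-suc _ _ ⟨
  length (zeros f xs) + suc (∑ xs f) ≤⟨ +-monoʳ-≤ _ (s≤s (m≤n+m _ k)) ⟩
  length (zeros f xs) + suc (k + ∑ xs f) ∎
  where open ≤-Reasoning

length<zeros+∑ : ∀ {xs : List A} {x} f → x ∈ xs → 2 ≤ f x → length xs < length (zeros f xs) + ∑ xs f
length<zeros+∑ {xs = x ∷ xs} f (here refl) 2≤fx with f x | 2≤fx
... | suc zero | s≤s ()
... | suc (suc k) | _ = begin-strict
  suc (length xs)                        ≤⟨ s≤s (length≤zeros+∑ xs f) ⟩
  suc (length (zeros f xs) + ∑ xs f)     <⟨ s≤s (≤-reflexive (sym (+-suc _ _))) ⟩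
  suc (length (zeros f xs) + suc (∑ xs f)) ≡⟨ +-suc _ _ ⟨
  length (zeros f xs) + suc (suc (∑ xs f)) ≤⟨ +-monoʳ-≤ _ (s≤s (s≤s (m≤n+m _ k))) ⟩
  length (zeros f xs) + suc (suc (k + ∑ xs f)) ∎
  where open ≤-Reasoning
length<zeros+∑ {xs = y ∷ xs} f (there x∈xs) 2≤fx with f y
... | zero  = s≤s (length<zeros+∑ f x∈xs 2≤fx)
... | suc k = begin-strict
  suc (length xs)                      <⟨ s≤s (length<zeros+∑ f x∈xs 2≤fx) ⟩
  suc (length (zeros f xs) + ∑ xs f)   ≡⟨ +-suc _ _ ⟨
  length (zeros f xs) + suc (∑ xs f)   ≤⟨ +-monoʳ-≤ _ (s≤s (m≤n+m _ k)) ⟩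
  length (zeros f xs) + suc (k + ∑ xs f) ∎
  where open ≤-Reasoning

∑≤1 : ∀ {xs : List A} f → Unique xs → (∀ x → f x ≤ 1) →
      (∀ {x y} → x ∈ xs → y ∈ xs → 0 < f x → 0 < f y → x ≡ y) → ∑ xs f ≤ 1
∑≤1 {xs = []} f _ _ _ = z≤n
∑≤1 {xs = x ∷ xs} f (x∉xs ∷ unique) f≤1 positives-equal with f x in fx≡
... | zero = ∑≤1 f unique f≤1 (λ x∈ y∈ → positives-equal (there x∈) (there y∈))
... | suc n = begin
  suc n + ∑ xs f   ≡⟨ cong (suc n +_) (∑-zero xs others-zero) ⟩
  suc n + 0        ≡⟨ +-identityʳ _ ⟩
  suc n            ≡⟨ fx≡ ⟨
  f x              ≤⟨ f≤1 x ⟩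
  1                ∎
  where
  open ≤-Reasoning
  others-zero : ∀ {y} → y ∈ xs → f y ≡ 0
  others-zero {y} y∈xs with f y in fy≡
  ... | zero = refl
  ... | suc _ = ⊥-elim (All.lookup x∉xs y∈xs
                  (positives-equal (here refl) (there y∈xs)
                                   (subst (0 <_) (sym fx≡) (s≤s z≤n)) (subst (0 <_) (sym fy≡) (s≤s z≤n))))

𝟙 : {P : Set} → Dec P → ℕ
𝟙 d = if does d then 1 else 0

𝟙-yes : ∀ {P : Set} (d : Dec P) → P → 𝟙 d ≡ 1
𝟙-yes (yes _) _ = refl
𝟙-yes (no ¬p) p = ⊥-elim (¬p p)

𝟙-no : ∀ {P : Set} (d : Dec P) → ¬ P → 𝟙 d ≡ 0
𝟙-no (yes p) ¬p = ⊥-elim (¬p p)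
𝟙-no (no _) _ = refl

𝟙≤1 : ∀ {P : Set} (d : Dec P) → 𝟙 d ≤ 1
𝟙≤1 (yes _) = ≤-refl
𝟙≤1 (no _) = z≤n

𝟙-positive : ∀ {P : Set} (d : Dec P) → 0 < 𝟙 d → P
𝟙-positive (yes p) _ = p

𝟙-mono : ∀ {P R : Set} → (P → R) → (p? : Dec P) (r? : Dec R) → 𝟙 p? ≤ 𝟙 r?
𝟙-mono P→R (yes p) (yes _) = ≤-refl
𝟙-mono P→R (yes p) (no ¬r) = ⊥-elim (¬r (P→R p))
𝟙-mono P→R (no _) _ = z≤n

∑ᵥ-lookup : ∀ (xs : List A) f → ∑ᵥ (f ∘ List.lookup xs) ≡ ∑ xs f
∑ᵥ-lookup [] f = refl
∑ᵥ-lookup (x ∷ xs) f = cong (f x +_) (∑ᵥ-lookup xs f)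

∑ᵥ-injective : ∀ {k n} (h : Fin n → ℕ) {σ : Fin k → Fin n} → Injective _≡_ _≡_ σ → ∑ᵥ (h ∘ σ) ≤ ∑ᵥ h
∑ᵥ-injective {zero} h σ-inj = z≤n
∑ᵥ-injective {suc k} {zero} h {σ} σ-inj with σ zero
... | ()
∑ᵥ-injective {suc k} {suc n} h {σ} σ-inj = begin
  h (σ zero) + ∑ᵥ (h ∘ σ ∘ suc)          ≡⟨ cong (h (σ zero) +_) (sum-cong-≗ h∘σ∘suc≗) ⟩
  h (σ zero) + ∑ᵥ (h′ ∘ σ′)              ≤⟨ +-monoʳ-≤ (h (σ zero)) (∑ᵥ-injective h′ σ′-inj) ⟩
  h (σ zero) + ∑ᵥ h′                     ≡⟨ sum-remove h ⟨
  ∑ᵥ h                                   ∎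
  where
  open ≤-Reasoning
  σ0≢ : ∀ i → σ zero ≢ σ (suc i)
  σ0≢ i eq with σ-inj eq
  ... | ()
  h′ = h ∘ punchIn (σ zero)
  σ′ : Fin k → Fin n
  σ′ i = punchOut (σ0≢ i)
  h∘σ∘suc≗ : ∀ i → h (σ (suc i)) ≡ h′ (σ′ i)
  h∘σ∘suc≗ i = cong h (sym (Finₚ.punchIn-punchOut (σ0≢ i)))
  σ′-inj : Injective _≡_ _≡_ σ′
  σ′-inj eq = Finₚ.suc-injective (σ-inj (Finₚ.punchOut-injective (σ0≢ _) (σ0≢ _) eq))

module Multiplicity {X : Set} (_≟ₓ_ : DecidableEquality X) where

  #[_] : ∀ {n} → X → (Fin n → X) → ℕ
  #[ t ] p = ∑ᵥ (λ i → 𝟙 (p i ≟ₓ t))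

  mult : X → List X → ℕ
  mult t xs = ∑[ x ∈ xs ] 𝟙 (x ≟ₓ t)

  embedding⇒#≤ : ∀ {k n} {f : Fin k → X} {p : Fin n → X} {σ : Fin k → Fin n} →
                Injective _≡_ _≡_ σ → (∀ j → p (σ j) ≡ f j) → ∀ t → #[ t ] f ≤ #[ t ] p
  embedding⇒#≤ {f = f} {p} {σ} σ-inj p∘σ≗f t =
    subst (_≤ #[ t ] p) (sum-cong-≗ (λ j → cong (λ x → 𝟙 (x ≟ₓ t)) (p∘σ≗f j)))
      (∑ᵥ-injective (λ i → 𝟙 (p i ≟ₓ t)) σ-inj)

  #-positive : ∀ {n} t (p : Fin n → X) → 0 < #[ t ] p → Σ (Fin n) λ i → p i ≡ t
  #-positive {suc n} t p pos with p zero ≟ₓ t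
  ... | yes p0≡t = zero , p0≡t
  ... | no _ with #-positive t (p ∘ suc) pos
  ...   | i , pi≡t = suc i , pi≡t

  #-head-positive : ∀ {k} (f : Fin (suc k) → X) → 0 < #[ f zero ] f
  #-head-positive f = subst (λ c → 0 < c + #[ f zero ] (f ∘ suc)) (sym (𝟙-yes (f zero ≟ₓ f zero) refl)) (s≤s z≤n)

  #≤-remove : ∀ {k n} {f : Fin (suc k) → X} {p : Fin (suc n) → X} i → p i ≡ f zero →
             (∀ t → #[ t ] f ≤ #[ t ] p) → ∀ t → #[ t ] (f ∘ suc) ≤ #[ t ] (p ∘ punchIn i)
  #≤-remove {f = f} {p} i pi≡f0 f≤p t = +-cancelˡ-≤ (𝟙 (f zero ≟ₓ t)) _ _ (begin
    𝟙 (f zero ≟ₓ t) + #[ t ] (f ∘ suc)     ≤⟨ f≤p t ⟩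
    #[ t ] p                               ≡⟨ sum-remove (λ j → 𝟙 (p j ≟ₓ t)) ⟩
    𝟙 (p i ≟ₓ t) + #[ t ] (p ∘ punchIn i)  ≡⟨ cong (λ x → 𝟙 (x ≟ₓ t) + #[ t ] (p ∘ punchIn i)) pi≡f0 ⟩
    𝟙 (f zero ≟ₓ t) + #[ t ] (p ∘ punchIn i) ∎)
    where open ≤-Reasoning

  #≤⇒embedding : ∀ {k n} (f : Fin k → X) (p : Fin n → X) → (∀ t → #[ t ] f ≤ #[ t ] p) →
                Σ (Fin k → Fin n) λ σ → Injective _≡_ _≡_ σ × (∀ j → p (σ j) ≡ f j)
  #≤⇒embedding {zero} f p _ = (λ ()) , (λ { {()} }) , (λ ())
  #≤⇒embedding {suc k} {zero} f p f≤p = ⊥-elim (<-irrefl refl (≤-trans (#-head-positive f) (f≤p (f zero))))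
  #≤⇒embedding {suc k} {suc n} f p f≤p
    with i , pi≡f0 ← #-positive (f zero) p (≤-trans (#-head-positive f) (f≤p (f zero)))
    with σ′ , σ′-inj , p∘σ′≗f ← #≤⇒embedding (f ∘ suc) (p ∘ punchIn i) (#≤-remove {f = f} {p = p} i pi≡f0 f≤p)
    = σ , σ-inj , p∘σ≗f
    where
    σ : Fin (suc k) → Fin (suc n)
    σ zero = i
    σ (suc j) = punchIn i (σ′ j)
    σ-inj : Injective _≡_ _≡_ σ
    σ-inj {zero} {zero} _ = refl
    σ-inj {zero} {suc j} eq = ⊥-elim (Finₚ.punchInᵢ≢i i (σ′ j) (sym eq))
    σ-inj {suc j} {zero} eq = ⊥-elim (Finₚ.punchInᵢ≢i i (σ′ j) eq)
    σ-inj {suc j} {suc j′} eq = cong suc (σ′-inj (Finₚ.punchIn-injective i _ _ eq))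
    p∘σ≗f : ∀ j → p (σ j) ≡ f j
    p∘σ≗f zero = pi≡f0
    p∘σ≗f (suc j) = p∘σ′≗f j

  mult-lookup : ∀ t (xs : List X) → #[ t ] (List.lookup xs) ≡ mult t xs
  mult-lookup t xs = ∑ᵥ-lookup xs (λ x → 𝟙 (x ≟ₓ t))

  mult-map : ∀ {Y : Set} t (g : Y → X) (ys : List Y) → #[ t ] (g ∘ List.lookup ys) ≡ mult t (map g ys)
  mult-map t g ys = trans (∑ᵥ-lookup ys (λ y → 𝟙 (g y ≟ₓ t))) (sym (∑-map g ys (λ x → 𝟙 (x ≟ₓ t))))

lookup-ext : ∀ {n} {x y : Vec A n} → (∀ l → lookup x l ≡ lookup y l) → x ≡ y
lookup-ext {x = x} {y} x≗y =
  trans (sym (Vec.tabulate∘lookup x)) (trans (Vec.tabulate-cong x≗y) (Vec.tabulate∘lookup y))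

restrict : ∀ {k m} → (Fin k → Fin m) → Vec A m → Vec A k
restrict ρ x = tabulate (lookup x ∘ ρ)

module _ {k m s : ℕ} where

  open Multiplicity {X = Vec (Fin s) k} (Vec.≡-dec Finₚ._≟_)

  ≺⇒mult≤ : (F : Matrix k s) (A : Matrix m s) → F ≺ A →
            Σ (Fin k → Fin m) λ ρ → Injective _≡_ _≡_ ρ × (∀ t → mult t F ≤ mult t (map (restrict ρ) A))
  ≺⇒mult≤ F A (ρ , σ , ρ-inj , σ-inj , entries) = ρ , ρ-inj , λ t →
    subst₂ _≤_ (mult-lookup t F) (mult-map t (restrict ρ) A)
               (embedding⇒#≤ {p = restrict ρ ∘ List.lookup A} σ-inj columns-agree t)
    where
    columns-agree : ∀ j → restrict ρ (List.lookup A (σ j)) ≡ List.lookup F j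
    columns-agree j = lookup-ext (λ i → trans (Vec.lookup∘tabulate _ i) (entries i j))

  mult≤⇒≺ : (F : Matrix k s) (A : Matrix m s) {ρ : Fin k → Fin m} → Injective _≡_ _≡_ ρ →
            (∀ t → mult t F ≤ mult t (map (restrict ρ) A)) → F ≺ A
  mult≤⇒≺ F A {ρ} ρ-inj F≤A = ρ , σ , ρ-inj , σ-inj , entries
    where
    embedding = #≤⇒embedding (List.lookup F) (restrict ρ ∘ List.lookup A)
                  (λ t → subst₂ _≤_ (sym (mult-lookup t F)) (sym (mult-map t (restrict ρ) A)) (F≤A t))
    σ = proj₁ embedding
    σ-inj = proj₁ (proj₂ embedding)
    entries : ∀ i j → entry A (ρ i) (σ j) ≡ entry F i j
    entries i j = trans (sym (Vec.lookup∘tabulate (lookup (List.lookup A (σ j)) ∘ ρ) i))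
                        (cong (λ x → lookup x i) (proj₂ (proj₂ embedding) j))

⟨_,_⟩ : ∀ {m} → Fin m → Fin m → Fin 2 → Fin m
⟨ r , s ⟩ zero = r
⟨ r , s ⟩ (suc _) = s

-- restrict ⟨ r , s ⟩ x reduces to rows r s x.
rows : ∀ {m} → Fin m → Fin m → Vec A m → Vec A 2
rows r s x = lookup x r ∷ lookup x s ∷ []

module _ {m q : ℕ} where

  open Multiplicity {X = Vec (Fin q) 2} (Vec.≡-dec Finₚ._≟_)

  ≺₂⇒mult≤ : (F : Matrix 2 q) (A : Matrix m q) → F ≺ A →
        Σ (Fin m) λ r → Σ (Fin m) λ s → r ≢ s × (∀ t → mult t F ≤ mult t (map (rows r s) A))
  ≺₂⇒mult≤ F A F≺A with ρ , ρ-inj , F≤A ← ≺⇒mult≤ F A F≺A =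
    ρ zero , ρ (suc zero) , (λ eq → Finₚ.0≢1+n (ρ-inj eq)) , F≤A

  mult≤⇒≺₂ : (F : Matrix 2 q) (A : Matrix m q) {r s : Fin m} → r ≢ s →
        (∀ t → mult t F ≤ mult t (map (rows r s) A)) → F ≺ A
  mult≤⇒≺₂ F A {r} {s} r≢s = mult≤⇒≺ F A ⟨,⟩-inj
    where
    ⟨,⟩-inj : Injective _≡_ _≡_ ⟨ r , s ⟩
    ⟨,⟩-inj {zero} {zero} _ = refl
    ⟨,⟩-inj {zero} {suc zero} eq = ⊥-elim (r≢s eq)
    ⟨,⟩-inj {suc zero} {zero} eq = ⊥-elim (r≢s (sym eq))
    ⟨,⟩-inj {suc zero} {suc zero} _ = refl

≺-mono : ∀ {k m q} (G F : Matrix k q) {A : Matrix m q} →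
         let open Multiplicity {X = Vec (Fin q) k} (Vec.≡-dec Finₚ._≟_) in
         (∀ t → mult t G ≤ mult t F) → F ≺ A → G ≺ A
≺-mono G F {A} G≤F F≺A with ρ , ρ-inj , F≤A ← ≺⇒mult≤ F A F≺A =
  mult≤⇒≺ G A ρ-inj (λ t → ≤-trans (G≤F t) (F≤A t))

Col : ℕ → Set
Col m = Vec (Fin 3) m

_≟₂_ : DecidableEquality (Col 2)
_≟₂_ = Vec.≡-dec Finₚ._≟_

open Multiplicity _≟₂_ using (mult)

data Pattern : Set where
  p00 p10 p01 p11 pI₂ : Pattern

hits : Pattern → Col 2 → ℕ
hits p00 v = 𝟙 (v ≟₂ c00)
hits p10 v = 𝟙 (v ≟₂ c10)
hits p01 v = 𝟙 (v ≟₂ c01)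
hits p11 v = 𝟙 (v ≟₂ c11)
hits pI₂ v = hits p10 v + hits p01 v

occ : ∀ {m} → Pattern → Fin m → Fin m → List (Col m) → ℕ
occ p r s A = ∑[ x ∈ A ] hits p (rows r s x)

occ≡mult : ∀ {m} p t → (∀ v → hits p v ≡ 𝟙 (v ≟₂ t)) → ∀ (r s : Fin m) A →
           occ p r s A ≡ mult t (map (rows r s) A)
occ≡mult p t hits≡ r s A = trans (∑-cong A (λ {x} _ → hits≡ (rows r s x))) (sym (∑-map (rows r s) A _))

mirror : Pattern → Pattern
mirror p00 = p00
mirror p10 = p01
mirror p01 = p10
mirror p11 = p11
mirror pI₂ = pI₂

swap : Col 2 → Col 2
swap (x ∷ y ∷ []) = y ∷ x ∷ []

swap-injective : ∀ v t → swap v ≡ swap t → v ≡ t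
swap-injective (x ∷ y ∷ []) (x′ ∷ y′ ∷ []) refl = refl

𝟙-swap : ∀ v t → 𝟙 (swap v ≟₂ swap t) ≡ 𝟙 (v ≟₂ t)
𝟙-swap v t = ≤-antisym (𝟙-mono (swap-injective v t) (swap v ≟₂ swap t) (v ≟₂ t))
                       (𝟙-mono (cong swap) (v ≟₂ t) (swap v ≟₂ swap t))

hits-mirror : ∀ p v → hits (mirror p) (swap v) ≡ hits p v
hits-mirror p00 v = 𝟙-swap v c00
hits-mirror p10 v = 𝟙-swap v c10
hits-mirror p01 v = 𝟙-swap v c01
hits-mirror p11 v = 𝟙-swap v c11
hits-mirror pI₂ v = trans (cong₂ _+_ (𝟙-swap v c01) (𝟙-swap v c10)) (+-comm (hits p01 v) (hits p10 v))

occ-mirror : ∀ {m} p (r s : Fin m) A → occ (mirror p) s r A ≡ occ p r s A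
occ-mirror p r s A = ∑-cong A (λ {x} _ → hits-mirror p (rows r s x))

occ-++ : ∀ {m} p (r s : Fin m) L L′ → occ p r s (L ++ L′) ≡ occ p r s L + occ p r s L′
occ-++ p r s L L′ = ∑-++ L L′ _

occ-tail : ∀ {m} p h (r s : Fin m) L → occ p (suc r) (suc s) (map (h ∷_) L) ≡ occ p r s L
occ-tail p h r s L = ∑-map (h ∷_) L _

occ-top : ∀ {m} p h (s : Fin m) L → occ p zero (suc s) (map (h ∷_) L) ≡ ∑[ y ∈ L ] hits p (h ∷ lookup y s ∷ [])
occ-top p h s L = ∑-map (h ∷_) L _

mult-replicate : ∀ n v t → mult t (List.replicate n v) ≡ 𝟙 (v ≟₂ t) * n
mult-replicate zero v t = sym (*-zeroʳ (𝟙 (v ≟₂ t)))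
mult-replicate (suc n) v t = trans (cong (𝟙 (v ≟₂ t) +_) (mult-replicate n v t)) (sym (*-suc (𝟙 (v ≟₂ t)) n))

mult-Fabcd : ∀ a b c d t → mult t (Fabcd a b c d) ≡
             𝟙 (c00 ≟₂ t) * a + (𝟙 (c10 ≟₂ t) * b + (𝟙 (c01 ≟₂ t) * c + 𝟙 (c11 ≟₂ t) * d))
mult-Fabcd a b c d t =
  trans (∑-++ (List.replicate a c00) _ _) (cong₂ _+_ (mult-replicate a c00 t)
  (trans (∑-++ (List.replicate b c10) _ _) (cong₂ _+_ (mult-replicate b c10 t)
  (trans (∑-++ (List.replicate c c01) _ _) (cong₂ _+_ (mult-replicate c c01 t) (mult-replicate d c11 t))))))

mult-Fabcd-mono : ∀ {a b c d a′ b′ c′ d′} → a ≤ a′ → b ≤ b′ → c ≤ c′ → d ≤ d′ →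
                  ∀ t → mult t (Fabcd a b c d) ≤ mult t (Fabcd a′ b′ c′ d′)
mult-Fabcd-mono {a} {b} {c} {d} {a′} {b′} {c′} {d′} a≤ b≤ c≤ d≤ t =
  subst₂ _≤_ (sym (mult-Fabcd a b c d t)) (sym (mult-Fabcd a′ b′ c′ d′ t))
    (+-mono-≤ (*-monoʳ-≤ (𝟙 (c00 ≟₂ t)) a≤) (+-mono-≤ (*-monoʳ-≤ (𝟙 (c10 ≟₂ t)) b≤)
      (+-mono-≤ (*-monoʳ-≤ (𝟙 (c01 ≟₂ t)) c≤) (*-monoʳ-≤ (𝟙 (c11 ≟₂ t)) d≤))))

mult-3·I₂ : ∀ t → mult t (3 · I₂) ≡ mult t (Fabcd 0 3 3 0)
mult-3·I₂ t =
  trans (as-Fabcd (𝟙 (c10 ≟₂ t)) (𝟙 (c01 ≟₂ t)) (𝟙 (c00 ≟₂ t)) (𝟙 (c11 ≟₂ t))) (sym (mult-Fabcd 0 3 3 0 t))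
  where
  as-Fabcd : ∀ x y z w → x + (y + (x + (y + (x + (y + 0))))) ≡ z * 0 + (x * 3 + (y * 3 + w * 0))
  as-Fabcd = solve-∀

mult-3·K₂ : ∀ t → mult t (3 · K₂) ≡ mult t (Fabcd 3 3 3 3)
mult-3·K₂ t =
  trans (as-Fabcd (𝟙 (c00 ≟₂ t)) (𝟙 (c10 ≟₂ t)) (𝟙 (c01 ≟₂ t)) (𝟙 (c11 ≟₂ t))) (sym (mult-Fabcd 3 3 3 3 t))
  where
  as-Fabcd : ∀ x y z w → x + (y + (z + (w + (x + (y + (z + (w + (x + (y + (z + (w + 0)))))))))))
                         ≡ x * 3 + (y * 3 + (z * 3 + w * 3))
  as-Fabcd = solve-∀

Fabcd-occ≺ : ∀ {m} {r s : Fin m} (A : List (Col m)) → r ≢ s →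
              Fabcd (occ p00 r s A) (occ p10 r s A) (occ p01 r s A) (occ p11 r s A) ≺ A
Fabcd-occ≺ {r = r} {s} A r≢s
  rewrite occ≡mult p00 c00 (λ _ → refl) r s A | occ≡mult p10 c10 (λ _ → refl) r s A
        | occ≡mult p01 c01 (λ _ → refl) r s A | occ≡mult p11 c11 (λ _ → refl) r s A
  = mult≤⇒≺₂ (Fabcd (mult c00 R) (mult c10 R) (mult c01 R) (mult c11 R)) A r≢s within
  where
  R = map (rows r s) A
  within : ∀ t → mult t (Fabcd (mult c00 R) (mult c10 R) (mult c01 R) (mult c11 R)) ≤ mult t R
  within t = subst (_≤ mult t R) (sym (mult-Fabcd _ _ _ _ t)) (by-cases t)
    where
    n+0+0≤n : ∀ n → n + 0 + 0 ≤ n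
    n+0+0≤n n = ≤-reflexive (trans (+-identityʳ _) (+-identityʳ n))
    by-cases : ∀ t → 𝟙 (c00 ≟₂ t) * mult c00 R + (𝟙 (c10 ≟₂ t) * mult c10 R + (𝟙 (c01 ≟₂ t) * mult c01 R
                     + 𝟙 (c11 ≟₂ t) * mult c11 R)) ≤ mult t R
    by-cases (0F ∷ 0F ∷ []) = n+0+0≤n _
    by-cases (1F ∷ 0F ∷ []) = n+0+0≤n _
    by-cases (0F ∷ 1F ∷ []) = n+0+0≤n _
    by-cases (1F ∷ 1F ∷ []) = ≤-reflexive (+-identityʳ _)
    by-cases (2F ∷ _ ∷ []) = z≤n
    by-cases (0F ∷ 2F ∷ []) = z≤n
    by-cases (1F ∷ 2F ∷ []) = z≤n

occ⇒Fabcd≺ : ∀ {m a b c d} {r s : Fin m} (A : List (Col m)) → r ≢ s →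
          a ≤ occ p00 r s A → b ≤ occ p10 r s A → c ≤ occ p01 r s A → d ≤ occ p11 r s A → Fabcd a b c d ≺ A
occ⇒Fabcd≺ {a = a} {b} {c} {d} {r} {s} A r≢s a≤ b≤ c≤ d≤ =
  ≺-mono (Fabcd a b c d) (Fabcd (occ p00 r s A) (occ p10 r s A) (occ p01 r s A) (occ p11 r s A)) {A}
    (mult-Fabcd-mono a≤ b≤ c≤ d≤) (Fabcd-occ≺ A r≢s)

Fabcd≺⇒3·I₂≺ : ∀ {m a b c d} {A : List (Col m)} → 3 ≤ b → 3 ≤ c → Fabcd a b c d ≺ A → (3 · I₂) ≺ A
Fabcd≺⇒3·I₂≺ {a = a} {b} {c} {d} {A} 3≤b 3≤c = ≺-mono (3 · I₂) (Fabcd a b c d) {A}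
  λ t → subst (_≤ mult t (Fabcd a b c d)) (sym (mult-3·I₂ t)) (mult-Fabcd-mono {a′ = a} {d′ = d} z≤n 3≤b 3≤c z≤n t)

3·I₂≺⇒occ : ∀ {m} (A : List (Col m)) → (3 · I₂) ≺ A →
          Σ (Fin m) λ r → Σ (Fin m) λ s → r ≢ s × 3 ≤ occ p10 r s A × 3 ≤ occ p01 r s A
3·I₂≺⇒occ A I≺A with r , s , r≢s , I≤A ← ≺₂⇒mult≤ (3 · I₂) A I≺A =
  r , s , r≢s , subst (3 ≤_) (sym (occ≡mult p10 c10 (λ _ → refl) r s A)) (I≤A c10)
              , subst (3 ≤_) (sym (occ≡mult p01 c01 (λ _ → refl) r s A)) (I≤A c01)

3·K₂≺⇒occ : ∀ {m} (A : List (Col m)) → (3 · K₂) ≺ A → Σ (Fin m) λ r → Σ (Fin m) λ s → r ≢ s × 3 ≤ occ p11 r s A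
3·K₂≺⇒occ A K≺A with r , s , r≢s , K≤A ← ≺₂⇒mult≤ (3 · K₂) A K≺A =
  r , s , r≢s , subst (3 ≤_) (sym (occ≡mult p11 c11 (λ _ → refl) r s A)) (K≤A c11)

occ≥3⇒3·K₂≺ : ∀ {m} {r s : Fin m} (A : List (Col m)) → r ≢ s →
          3 ≤ occ p00 r s A → 3 ≤ occ p10 r s A → 3 ≤ occ p01 r s A → 3 ≤ occ p11 r s A → (3 · K₂) ≺ A
occ≥3⇒3·K₂≺ A r≢s 3≤n₀₀ 3≤n₁₀ 3≤n₀₁ 3≤n₁₁ =
  ≺-mono (3 · K₂) (Fabcd 3 3 3 3) {A} (λ t → ≤-reflexive (mult-3·K₂ t)) (occ⇒Fabcd≺ A r≢s 3≤n₀₀ 3≤n₁₀ 3≤n₀₁ 3≤n₁₁)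

pairs : ∀ m → List (Fin m × Fin m)
pairs zero = []
pairs (suc m) = map (λ k → zero , suc k) (allFin m) ++ map (Prod.map suc suc) (pairs m)

∈-pairs : ∀ {m} {a b : Fin m} → a Fin.< b → (a , b) ∈ pairs m
∈-pairs {suc m} {zero} {suc k} _ = ∈-++⁺ˡ (∈-map⁺ (λ k → zero , suc k) (∈-allFin k))
∈-pairs {suc m} {suc a} {suc b} (s<s a<b) = ∈-++⁺ʳ _ (∈-map⁺ (Prod.map suc suc) (∈-pairs a<b))

∈-pairs⁻ : ∀ {m} {a b : Fin m} → (a , b) ∈ pairs m → a Fin.< b
∈-pairs⁻ {suc m} ab∈ with ∈-++⁻ (map (λ k → zero , suc k) (allFin m)) ab∈
... | inj₁ ab∈top with _ , _ , refl ← ∈-map⁻ (λ k → zero , suc k) ab∈top = z<s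
... | inj₂ ab∈rest with _ , ab∈′ , refl ← ∈-map⁻ (Prod.map suc suc) ab∈rest = s<s (∈-pairs⁻ ab∈′)

pairs-unique : ∀ m → Unique (pairs m)
pairs-unique zero = []
pairs-unique (suc m) =
  Unique.++⁺ (Unique.map⁺ (λ eq → Finₚ.suc-injective (cong proj₂ eq)) (Unique.allFin⁺ m))
             (Unique.map⁺ (λ eq → cong₂ _,_ (Finₚ.suc-injective (cong proj₁ eq))
                                            (Finₚ.suc-injective (cong proj₂ eq)))
                          (pairs-unique m))
             top∩rest≡∅
  where
  top∩rest≡∅ : ∀ {ab} → ¬ (ab ∈ map (λ k → zero , suc k) (allFin m) × ab ∈ map (Prod.map suc suc) (pairs m))
  top∩rest≡∅ (ab∈top , ab∈rest) with _ , _ , refl ← ∈-map⁻ (λ k → zero , suc k) ab∈top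
                                  with _ , _ , () ← ∈-map⁻ (Prod.map suc suc) ab∈rest

suc-C2 : ∀ m → suc m C 2 ≡ m + m C 2
suc-C2 m = trans (sym (nCk+nC[k+1]≡[n+1]C[k+1] m 1)) (cong (_+ m C 2) (nC1≡n m))

length-pairs : ∀ m → length (pairs m) ≡ m C 2
length-pairs zero = refl
length-pairs (suc m) = begin
  length (pairs (suc m))                  ≡⟨ length-++ (map (λ k → zero , suc k) (allFin m)) ⟩
  length (map _ (allFin m)) + length (map _ (pairs m))
    ≡⟨ cong₂ _+_ (trans (length-map _ (allFin m)) (length-tabulate _))
                 (trans (length-map _ (pairs m)) (length-pairs m)) ⟩
  m + m C 2                               ≡⟨ suc-C2 m ⟨
  suc m C 2                               ∎
  where open ≡-Reasoning

2*C2≤m*m : ∀ m → 2 * (m C 2) ≤ m * m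
2*C2≤m*m zero = z≤n
2*C2≤m*m (suc m) = begin
  2 * (suc m C 2)          ≡⟨ cong (2 *_) (suc-C2 m) ⟩
  2 * (m + m C 2)          ≡⟨ *-distribˡ-+ 2 m (m C 2) ⟩
  2 * m + 2 * (m C 2)      ≤⟨ +-monoʳ-≤ (2 * m) (2*C2≤m*m m) ⟩
  2 * m + m * m            ≤⟨ n≤1+n _ ⟩
  suc (2 * m + m * m)      ≡⟨ square-suc m ⟩
  suc m * suc m            ∎
  where
  open ≤-Reasoning
  square-suc : ∀ m → suc (2 * m + m * m) ≡ suc m * suc m
  square-suc = solve-∀

∑-pairs-const : ∀ m c → ∑[ ab ∈ pairs m ] c ≡ c * (m C 2)
∑-pairs-const m c = trans (∑-const (pairs m) c) (trans (cong (_* c) (length-pairs m)) (*-comm (m C 2) c))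

-- Only the patterns at pairs a < b are ever used.
Assignment : ℕ → Set
Assignment m = Fin m → Fin m → Pattern

lower : ∀ {m} → Assignment (suc m) → Assignment m
lower P i j = P (suc i) (suc j)

hitsAt : ∀ {m} → Assignment m → Col m → Fin m × Fin m → ℕ
hitsAt P x (a , b) = hits (P a b) (rows a b x)

weight : ∀ {m} → Assignment m → Col m → ℕ
weight {m} P x = ∑ (pairs m) (hitsAt P x)

topWeight : ∀ {m} → Assignment (suc m) → Fin 3 → Col m → ℕ
topWeight {m} P h y = ∑[ k ∈ allFin m ] hits (P zero (suc k)) (h ∷ lookup y k ∷ [])

weight-∷ : ∀ {m} (P : Assignment (suc m)) h y → weight P (h ∷ y) ≡ topWeight P h y + weight (lower P) y
weight-∷ {m} P h y = begin
  weight P (h ∷ y)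
    ≡⟨ ∑-++ (map (λ k → zero , suc k) (allFin m)) _ (hitsAt P (h ∷ y)) ⟩
  ∑ (map (λ k → zero , suc k) (allFin m)) (hitsAt P (h ∷ y))
    + ∑ (map (Prod.map suc suc) (pairs m)) (hitsAt P (h ∷ y))
    ≡⟨ cong₂ _+_ (∑-map (λ k → zero , suc k) (allFin m) _) (∑-map (Prod.map suc suc) (pairs m) _) ⟩
  topWeight P h y + weight (lower P) y ∎
  where open ≡-Reasoning

occAt : ∀ {m} → Assignment m → List (Col m) → Fin m × Fin m → ℕ
occAt P A (a , b) = occ (P a b) a b A

∑weight≡∑occ : ∀ {m} (P : Assignment m) A → ∑ A (weight P) ≡ ∑ (pairs m) (occAt P A)
∑weight≡∑occ {m} P A = ∑-comm A (pairs m) (hitsAt P)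

∑weight≤ : ∀ {m} (P : Assignment m) A {c} → (∀ a b → a Fin.< b → occ (P a b) a b A ≤ c) →
           ∑ A (weight P) ≤ c * (m C 2)
∑weight≤ {m} P A {c} occ≤c = begin
  ∑ A (weight P)             ≡⟨ ∑weight≡∑occ P A ⟩
  ∑ (pairs m) (occAt P A)    ≤⟨ ∑-mono (pairs m) (λ {ab} ab∈ → occ≤c (proj₁ ab) (proj₂ ab) (∈-pairs⁻ ab∈)) ⟩
  ∑[ ab ∈ pairs m ] c        ≡⟨ ∑-pairs-const m c ⟩
  c * (m C 2)                ∎
  where open ≤-Reasoning

∑weight< : ∀ {m} (P : Assignment m) A {c a b} → (∀ a b → a Fin.< b → occ (P a b) a b A ≤ c) →
           a Fin.< b → occ (P a b) a b A < c → ∑ A (weight P) < c * (m C 2)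
∑weight< {m} P A {c} occ≤c a<b occ<c = begin-strict
  ∑ A (weight P)             ≡⟨ ∑weight≡∑occ P A ⟩
  ∑ (pairs m) (occAt P A)    <⟨ ∑-mono-< (λ {ab} ab∈ → occ≤c (proj₁ ab) (proj₂ ab) (∈-pairs⁻ ab∈))
                                        (∈-pairs a<b) occ<c ⟩
  ∑[ ab ∈ pairs m ] c        ≡⟨ ∑-pairs-const m c ⟩
  c * (m C 2)                ∎
  where open ≤-Reasoning

assignment : ∀ {m} {R : Fin m → Fin m → Pattern → Set} → (∀ a b → a Fin.< b → Σ Pattern (R a b)) →
             Σ (Assignment m) λ P → ∀ a b → a Fin.< b → R a b (P a b)
assignment {R = R} choose = P , R-P
  where
  P : Assignment _
  P a b with a Finₚ.<? b
  ... | yes a<b = proj₁ (choose a b a<b)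
  ... | no _ = p00
  R-P : ∀ a b → a Fin.< b → R a b (P a b)
  R-P a b a<b with a Finₚ.<? b
  ... | yes a<b′ = proj₂ (choose a b a<b′)
  ... | no a≮b = ⊥-elim (a≮b a<b)

-- Standard induction with slack

box : ∀ {m} → (Fin m → List A) → List (Vec A m)
box {m = zero} S = [] ∷ []
box {m = suc m} S = cartesianProductWith _∷_ (S zero) (box (S ∘ suc))

∈-box : ∀ {m} (S : Fin m → List A) {x} → (∀ k → lookup x k ∈ S k) → x ∈ box S
∈-box {m = zero} S {[]} _ = here refl
∈-box {m = suc m} S {x ∷ xs} x∈S = ∈-cartesianProductWith⁺ _∷_ (x∈S zero) (∈-box (S ∘ suc) (x∈S ∘ suc))

length-cartesianProductWith : ∀ {C : Set} (f : A → B → C) xs ys →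
                              length (cartesianProductWith f xs ys) ≡ length xs * length ys
length-cartesianProductWith f [] ys = refl
length-cartesianProductWith f (x ∷ xs) ys =
  trans (length-++ (map (f x) ys))
        (cong₂ _+_ (length-map (f x) ys) (length-cartesianProductWith f xs ys))

length-box : ∀ {m} (S : Fin m → List A) → (∀ k → length (S k) ≤ 2) → length (box S) ≤ 2 ^ m
length-box {m = zero} S _ = ≤-refl
length-box {m = suc m} S S≤2 =
  subst (_≤ 2 ^ suc m) (sym (length-cartesianProductWith _∷_ (S zero) (box (S ∘ suc))))
        (*-mono-≤ (S≤2 zero) (length-box (S ∘ suc) (S≤2 ∘ suc)))

length-box-thin : ∀ {m} (S : Fin m → List A) → (∀ k → length (S k) ≤ 2) → ∀ k → length (S k) ≤ 1 →
                  2 * length (box S) ≤ 2 ^ m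
length-box-thin {m = suc m} S S≤2 k Sk≤1 =
  subst (λ n → 2 * n ≤ 2 ^ suc m) (sym (length-cartesianProductWith _∷_ (S zero) (box (S ∘ suc)))) (thin k Sk≤1)
  where
  thin : ∀ k → length (S k) ≤ 1 → 2 * (length (S zero) * length (box (S ∘ suc))) ≤ 2 ^ suc m
  thin zero S0≤1 = *-monoʳ-≤ 2 (≤-trans (*-monoˡ-≤ _ S0≤1)
                     (≤-trans (≤-reflexive (*-identityˡ _)) (length-box (S ∘ suc) (S≤2 ∘ suc))))
  thin (suc k) Sk≤1 = begin
    2 * (length (S zero) * length (box (S ∘ suc)))   ≡⟨ x*[y*z]≡y*[x*z] 2 (length (S zero)) _ ⟩
    length (S zero) * (2 * length (box (S ∘ suc)))
      ≤⟨ *-mono-≤ (S≤2 zero) (length-box-thin (S ∘ suc) (S≤2 ∘ suc) k Sk≤1) ⟩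
    2 * 2 ^ m                                        ∎
    where
    open ≤-Reasoning
    x*[y*z]≡y*[x*z] : ∀ a b c → a * (b * c) ≡ b * (a * c)
    x*[y*z]≡y*[x*z] = solve-∀

free : Pattern → List (Fin 3)
free p00 = 2F ∷ 1F ∷ []
free p10 = 2F ∷ 1F ∷ []
free p01 = 2F ∷ 0F ∷ []
free p11 = 2F ∷ 0F ∷ []
free pI₂ = 2F ∷ []

length-free : ∀ p → length (free p) ≤ 2
length-free p00 = ≤-refl
length-free p10 = ≤-refl
length-free p01 = ≤-refl
length-free p11 = ≤-refl
length-free pI₂ = s≤s z≤n

∈-free : ∀ p v → hits p (0F ∷ v ∷ []) + hits p (1F ∷ v ∷ []) ≡ 0 → v ∈ free p
∈-free p00 2F _ = here refl
∈-free p10 2F _ = here refl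
∈-free p01 2F _ = here refl
∈-free p11 2F _ = here refl
∈-free pI₂ 2F _ = here refl
∈-free p00 1F _ = there (here refl)
∈-free p10 1F _ = there (here refl)
∈-free p01 0F _ = there (here refl)
∈-free p11 0F _ = there (here refl)
∈-free p00 0F ()
∈-free p10 0F ()
∈-free p01 1F ()
∈-free p11 1F ()
∈-free pI₂ 0F ()
∈-free pI₂ 1F ()

hits-2F : ∀ p v → hits p (2F ∷ v ∷ []) ≡ 0
hits-2F p00 v = refl
hits-2F p10 v = refl
hits-2F p01 v = refl
hits-2F p11 v = refl
hits-2F pI₂ v = refl

2F∈free : ∀ p → 2F ∈ free p
2F∈free p00 = here refl
2F∈free p10 = here refl
2F∈free p01 = here refl
2F∈free p11 = here refl
2F∈free pI₂ = here refl

topFree : ∀ {m} → Assignment (suc m) → Fin m → List (Fin 3)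
topFree P k = free (P zero (suc k))

freeBox : ∀ {m} → Assignment (suc m) → List (Col m)
freeBox P = box (topFree P)

length-freeBox : ∀ {m} (P : Assignment (suc m)) → length (freeBox P) ≤ 2 ^ m
length-freeBox P = length-box (topFree P) (λ k → length-free (P zero (suc k)))

-- g m = (m + 2) · 2 ^ (m ∸ 1) for m ≥ 1; it is the size of the family T₀ of the extremal matrices.
g : ℕ → ℕ
g zero = 1
g (suc m) = g m + g m + 2 ^ m

-- The gain of the induction step over its plain bound: the tails of zero weight that occur
-- under both 0 and 1 lie in freeBox P, which halves when the top row is paired with pI₂,
-- and which in the free-top case also contains a tail of positive weight.
data TopSlack {m} (P : Assignment (suc m)) : ℕ → Set where
  no-top-slack : TopSlack P 0
  thin-top     : ∀ k → P zero (suc k) ≡ pI₂ → TopSlack P (2 ^ (m ∸ 1))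
  free-top     : ∀ y → y ∈ freeBox P → 0 < weight (lower P) y → TopSlack P 1

data Slack : ∀ m → Assignment m → ℕ → Set where
  no-slack : ∀ {m P} → Slack m P 0
  slack-∷  : ∀ {m P s t} → Slack m (lower P) s → TopSlack P t → Slack (suc m) P (s + s + t)

topPart : ∀ {m} → Assignment (suc m) → Col m → ℕ
topPart P y = weight (lower P) y + (topWeight P 0F y + topWeight P 1F y)

free-topPart : ∀ {m} (P : Assignment (suc m)) y → topPart P y ≡ 0 → ∀ k → lookup y k ∈ topFree P k
free-topPart P y part≡0 k = ∈-free (P zero (suc k)) (lookup y k)
  (cong₂ _+_ (∑≡0⇒ (m+n≡0⇒m≡0 _ top≡0) (∈-allFin k)) (∑≡0⇒ (m+n≡0⇒n≡0 _ top≡0) (∈-allFin k)))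
  where
  top≡0 = m+n≡0⇒n≡0 (weight (lower P) y) part≡0

zeros⊆freeBox : ∀ {m} (P : Assignment (suc m)) {Z} → Unique Z → (∀ {y} → y ∈ Z → topPart P y ≡ 0) →
                length Z ≤ length (freeBox P)
zeros⊆freeBox P unique part≡0 = length-⊆ unique (λ {y} y∈Z → ∈-box (topFree P) (free-topPart P y (part≡0 y∈Z)))

zeros-bound : ∀ {m} {P : Assignment (suc m)} {t} {Z} → TopSlack P t → Unique Z →
              (∀ {y} → y ∈ Z → topPart P y ≡ 0) → length Z + t ≤ 2 ^ m
zeros-bound {m} {P} {Z = Z} no-top-slack unique part≡0 =
  subst (_≤ 2 ^ m) (sym (+-identityʳ (length Z))) (≤-trans (zeros⊆freeBox P unique part≡0) (length-freeBox P))
zeros-bound {suc m} {P} {Z = Z} (thin-top k Pk≡I₂) unique part≡0 = begin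
  length Z + 2 ^ m        ≤⟨ +-monoˡ-≤ (2 ^ m) (≤-trans (zeros⊆freeBox P unique part≡0) half-box) ⟩
  2 ^ m + 2 ^ m           ≡⟨ cong (2 ^ m +_) (+-identityʳ (2 ^ m)) ⟨
  2 ^ suc m               ∎
  where
  open ≤-Reasoning
  half-box : length (freeBox P) ≤ 2 ^ m
  half-box = *-cancelˡ-≤ 2 (length-box-thin (topFree P) (λ k → length-free (P zero (suc k))) k
                              (subst (λ p → length (free p) ≤ 1) (sym Pk≡I₂) ≤-refl))
zeros-bound {m} {P} {Z = Z} (free-top y y∈box positive) unique part≡0 =
  subst (_≤ 2 ^ m) (+-comm 1 (length Z)) (≤-trans (length-⊆ (y∉Z ∷ unique) y∷Z⊆box) (length-freeBox P))
  where
  y∉Z : All (y ≢_) Z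
  y∉Z = All.tabulate λ { y∈Z refl → <⇒≢ (≤-trans positive (m≤m+n _ _)) (sym (part≡0 y∈Z)) }
  y∷Z⊆box : ∀ {x} → x ∈ y ∷ Z → x ∈ freeBox P
  y∷Z⊆box (here refl) = y∈box
  y∷Z⊆box {x} (there x∈Z) = ∈-box (topFree P) (free-topPart P x (part≡0 x∈Z))

top-bound : ∀ {m} {P : Assignment (suc m)} {t} {D} → TopSlack P t → Unique D →
            length D + t ≤ 2 ^ m + ∑ D (topPart P)
top-bound {m} {P} {t} {D} slack unique = begin
  length D + t                          ≤⟨ +-monoˡ-≤ t (length≤zeros+∑ D (topPart P)) ⟩
  length Z + ∑ D (topPart P) + t        ≡⟨ xy∙z≈xz∙y (length Z) _ t ⟩
  length Z + t + ∑ D (topPart P)        ≤⟨ +-monoˡ-≤ _ (zeros-bound slack (Unique.filter⁺ _ unique) Z-zero) ⟩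
  2 ^ m + ∑ D (topPart P)               ∎
  where
  open ≤-Reasoning
  Z = zeros (topPart P) D
  Z-zero : ∀ {y} → y ∈ Z → topPart P y ≡ 0
  Z-zero y∈Z = proj₂ (∈-filter⁻ (λ y → topPart P y ≟ 0) {xs = D} y∈Z)

slice : ∀ {m} → Fin 3 → List (Col (suc m)) → List (Col m)
slice h [] = []
slice h ((v ∷ y) ∷ A) with v Finₚ.≟ h
... | yes _ = y ∷ slice h A
... | no _  = slice h A

∈-slice : ∀ {m} h (A : List (Col (suc m))) {y} → y ∈ slice h A → (h ∷ y) ∈ A
∈-slice h ((v ∷ z) ∷ A) y∈ with v Finₚ.≟ h
∈-slice h ((v ∷ z) ∷ A) (here refl) | yes refl = here refl
∈-slice h ((v ∷ z) ∷ A) (there y∈) | yes _ = there (∈-slice h A y∈)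
... | no _ = there (∈-slice h A y∈)

slice-unique : ∀ {m} h {A : List (Col (suc m))} → Unique A → Unique (slice h A)
slice-unique h {[]} [] = []
slice-unique h {(v ∷ y) ∷ A} (x∉A ∷ unique) with v Finₚ.≟ h
... | yes refl = All.tabulate (λ z∈ y≡z → All.lookup x∉A (∈-slice v A z∈) (cong (v ∷_) y≡z)) ∷ slice-unique h unique
... | no _ = slice-unique h unique

∑-slice : ∀ {m} (A : List (Col (suc m))) f →
          ∑ A f ≡ ∑ (slice 0F A) (f ∘ (0F ∷_)) + (∑ (slice 1F A) (f ∘ (1F ∷_)) + ∑ (slice 2F A) (f ∘ (2F ∷_)))
∑-slice [] f = refl
∑-slice ((0F ∷ y) ∷ A) f rewrite ∑-slice A f = sym (+-assoc (f (0F ∷ y)) _ _)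
∑-slice ((1F ∷ y) ∷ A) f rewrite ∑-slice A f =
  into-second (f (1F ∷ y)) (∑ (slice 0F A) (f ∘ (0F ∷_)))
              (∑ (slice 1F A) (f ∘ (1F ∷_))) (∑ (slice 2F A) (f ∘ (2F ∷_)))
  where
  into-second : ∀ x a b c → x + (a + (b + c)) ≡ a + (x + b + c)
  into-second = solve-∀
∑-slice ((2F ∷ y) ∷ A) f rewrite ∑-slice A f =
  into-third (f (2F ∷ y)) (∑ (slice 0F A) (f ∘ (0F ∷_)))
             (∑ (slice 1F A) (f ∘ (1F ∷_))) (∑ (slice 2F A) (f ∘ (2F ∷_)))
  where
  into-third : ∀ x a b c → x + (a + (b + c)) ≡ a + (b + (x + c))
  into-third = solve-∀

length-slice : ∀ {m} (A : List (Col (suc m))) →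
               length A ≡ length (slice 0F A) + (length (slice 1F A) + length (slice 2F A))
length-slice A = trans (length≡∑1 A) (trans (∑-slice A (λ _ → 1))
  (sym (cong₂ _+_ (length≡∑1 (slice 0F A)) (cong₂ _+_ (length≡∑1 (slice 1F A)) (length≡∑1 (slice 2F A))))))

module _ {m} (P : Assignment (suc m)) {s} (IH : ∀ A → Unique A → length A + s ≤ g m + ∑ A (weight (lower P))) where

  private
    w = weight (lower P)
    τ = topWeight P
    open DecMembership {A = Col m} (Vec.≡-dec Finₚ._≟_) using (_∈?_)

  -- Tails occurring under both 0 and 1 are handled by top-bound; the others merge with B₁
  -- into one simple matrix with a row fewer.
  two-slices-bound : ∀ {t} {B₀ B₁ : List (Col m)} → TopSlack P t → Unique B₀ → Unique B₁ →
    length B₀ + length B₁ + (s + t) ≤ g m + 2 ^ m + (∑[ y ∈ B₀ ] (τ 0F y + w y) + ∑[ y ∈ B₁ ] (τ 1F y + w y))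
  two-slices-bound {t} {B₀} {B₁} slack B₀-unique B₁-unique = begin
    length B₀ + length B₁ + (s + t)
      ≡⟨ cong (λ n → n + length B₁ + (s + t)) (length-filter (_∈? B₁) B₀) ⟩
    length D + length E + length B₁ + (s + t)
      ≡⟨ regroup-lengths (length D) (length E) (length B₁) s t ⟩
    (length B₁ + length E + s) + (length D + t)
      ≡⟨ cong (λ n → n + s + (length D + t)) (length-++ B₁) ⟨
    (length (B₁ ++ E) + s) + (length D + t)
      ≤⟨ +-mono-≤ (IH (B₁ ++ E) U-unique) (top-bound slack D-unique) ⟩
    (g m + ∑ (B₁ ++ E) w) + (2 ^ m + ∑ D (topPart P))
      ≡⟨ cong₂ (λ a b → (g m + a) + (2 ^ m + b)) (∑-++ B₁ E w) D-parts ⟩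
    (g m + (∑ B₁ w + ∑ E w)) + (2 ^ m + (∑ D w + (∑ D (τ 0F) + ∑ D (τ 1F))))
      ≤⟨ +-monoʳ-≤ (g m + (∑ B₁ w + ∑ E w)) (+-monoʳ-≤ (2 ^ m) (+-monoʳ-≤ (∑ D w) (+-mono-≤ τ0-D τ1-D))) ⟩
    (g m + (∑ B₁ w + ∑ E w)) + (2 ^ m + (∑ D w + (∑ B₀ (τ 0F) + ∑ B₁ (τ 1F))))
      ≡⟨ regroup-sums (g m) (2 ^ m) (∑ B₁ w) (∑ E w) (∑ D w) (∑ B₀ (τ 0F)) (∑ B₁ (τ 1F)) ⟩
    g m + 2 ^ m + ((∑ B₀ (τ 0F) + (∑ D w + ∑ E w)) + (∑ B₁ (τ 1F) + ∑ B₁ w))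
      ≡⟨ cong (λ a → g m + 2 ^ m + ((∑ B₀ (τ 0F) + a) + (∑ B₁ (τ 1F) + ∑ B₁ w))) (∑-filter (_∈? B₁) B₀ w) ⟨
    g m + 2 ^ m + ((∑ B₀ (τ 0F) + ∑ B₀ w) + (∑ B₁ (τ 1F) + ∑ B₁ w))
      ≡⟨ cong (g m + 2 ^ m +_) (cong₂ _+_ (∑-distrib-+ B₀ (τ 0F) w) (∑-distrib-+ B₁ (τ 1F) w)) ⟨
    g m + 2 ^ m + (∑[ y ∈ B₀ ] (τ 0F y + w y) + ∑[ y ∈ B₁ ] (τ 1F y + w y)) ∎
    where
    open ≤-Reasoning
    D = filter (_∈? B₁) B₀
    E = filter (¬? ∘ (_∈? B₁)) B₀
    D-unique : Unique D
    D-unique = Unique.filter⁺ (_∈? B₁) B₀-unique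
    U-unique : Unique (B₁ ++ E)
    U-unique = Unique.++⁺ B₁-unique (Unique.filter⁺ (¬? ∘ (_∈? B₁)) B₀-unique)
      (λ (y∈B₁ , y∈E) → proj₂ (∈-filter⁻ (¬? ∘ (_∈? B₁)) {xs = B₀} y∈E) y∈B₁)
    D-parts : ∑ D (topPart P) ≡ ∑ D w + (∑ D (τ 0F) + ∑ D (τ 1F))
    D-parts = trans (∑-distrib-+ D w _) (cong (∑ D w +_) (∑-distrib-+ D (τ 0F) (τ 1F)))
    τ0-D : ∑ D (τ 0F) ≤ ∑ B₀ (τ 0F)
    τ0-D = ≤-trans (m≤m+n _ _) (≤-reflexive (sym (∑-filter (_∈? B₁) B₀ (τ 0F))))
    τ1-D : ∑ D (τ 1F) ≤ ∑ B₁ (τ 1F)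
    τ1-D = ∑-⊆ (τ 1F) D-unique (λ y∈D → proj₂ (∈-filter⁻ (_∈? B₁) {xs = B₀} y∈D))
    regroup-lengths : ∀ d e b₁ s t → d + e + b₁ + (s + t) ≡ (b₁ + e + s) + (d + t)
    regroup-lengths = solve-∀
    regroup-sums : ∀ G T W₁ Wₑ W_D τ₀ τ₁ →
      (G + (W₁ + Wₑ)) + (T + (W_D + (τ₀ + τ₁))) ≡ G + T + ((τ₀ + (W_D + Wₑ)) + (τ₁ + W₁))
    regroup-sums = solve-∀

  length+slack≤-∷ : ∀ {t} → TopSlack P t → ∀ A → Unique A → length A + (s + s + t) ≤ g (suc m) + ∑ A (weight P)
  length+slack≤-∷ {t} slack A unique = begin
    length A + (s + s + t)
      ≡⟨ cong (_+ (s + s + t)) (length-slice A) ⟩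
    length A₀ + (length A₁ + length A₂) + (s + s + t)
      ≡⟨ regroup-lengths (length A₀) (length A₁) (length A₂) s t ⟩
    (length A₂ + s) + (length A₀ + length A₁ + (s + t))
      ≤⟨ +-mono-≤ (IH A₂ (slice-unique 2F unique))
                  (two-slices-bound slack (slice-unique 0F unique) (slice-unique 1F unique)) ⟩
    (g m + ∑ A₂ w) + (g m + 2 ^ m + (S₀ + S₁))
      ≡⟨ regroup-sums (g m) (2 ^ m) (∑ A₂ w) S₀ S₁ ⟩
    g (suc m) + (S₀ + (S₁ + ∑ A₂ w))
      ≡⟨ cong (g (suc m) +_) weights ⟨
    g (suc m) + ∑ A (weight P) ∎
    where
    open ≤-Reasoning
    A₀ = slice 0F A
    A₁ = slice 1F A
    A₂ = slice 2F A
    S₀ = ∑[ y ∈ A₀ ] (τ 0F y + w y)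
    S₁ = ∑[ y ∈ A₁ ] (τ 1F y + w y)
    τ-2F : ∀ y → τ 2F y ≡ 0
    τ-2F y = ∑-zero (allFin m) (λ {k} _ → hits-2F (P zero (suc k)) (lookup y k))
    weights : ∑ A (weight P) ≡ S₀ + (S₁ + ∑ A₂ w)
    weights = trans (∑-slice A (weight P))
      (cong₂ _+_ (∑-cong A₀ (λ {y} _ → weight-∷ P 0F y))
                 (cong₂ _+_ (∑-cong A₁ (λ {y} _ → weight-∷ P 1F y))
                            (∑-cong A₂ (λ {y} _ → trans (weight-∷ P 2F y) (cong (_+ w y) (τ-2F y))))))
    regroup-lengths : ∀ a₀ a₁ a₂ s t → a₀ + (a₁ + a₂) + (s + s + t) ≡ (a₂ + s) + (a₀ + a₁ + (s + t))
    regroup-lengths = solve-∀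
    regroup-sums : ∀ G T W₂ S₀ S₁ → (G + W₂) + (G + T + (S₀ + S₁)) ≡ G + G + T + (S₀ + (S₁ + W₂))
    regroup-sums = solve-∀

length+slack≤ : ∀ {m} {P : Assignment m} {s} → Slack m P s → ∀ A → Unique A → length A + s ≤ g m + ∑ A (weight P)
length+slack≤ {zero} {P} no-slack A unique =
  ≤-trans (≤-reflexive (+-identityʳ (length A)))
          (≤-trans (length-⊆ {xs = [] ∷ []} unique λ { {[]} _ → here refl }) (m≤m+n 1 (∑ A (weight P))))
length+slack≤ {suc m} {P} no-slack = length+slack≤-∷ P (length+slack≤ {P = lower P} no-slack) no-top-slack
length+slack≤ {suc m} {P} (slack-∷ slack top) = length+slack≤-∷ P (length+slack≤ slack) top

small-pattern : ∀ {m} (A : List (Col m)) → ¬ ((3 · K₂) ≺ A) → ∀ a b → a Fin.< b → Σ Pattern λ p → occ p a b A ≤ 2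
small-pattern A K⊀A a b a<b with occ p00 a b A ≤? 2 | occ p10 a b A ≤? 2 | occ p01 a b A ≤? 2 | occ p11 a b A ≤? 2
... | yes n≤2 | _ | _ | _ = p00 , n≤2
... | no _ | yes n≤2 | _ | _ = p10 , n≤2
... | no _ | no _ | yes n≤2 | _ = p01 , n≤2
... | no _ | no _ | no _ | yes n≤2 = p11 , n≤2
... | no n₀₀≰2 | no n₁₀≰2 | no n₀₁≰2 | no n₁₁≰2 =
  ⊥-elim (K⊀A (occ≥3⇒3·K₂≺ A (Finₚ.<⇒≢ a<b) (≰⇒> n₀₀≰2) (≰⇒> n₁₀≰2) (≰⇒> n₀₁≰2) (≰⇒> n₁₁≰2)))

3·K₂-bound : ∀ {m} (A : List (Col m)) → Unique A → ¬ ((3 · K₂) ≺ A) → length A ≤ g m + 2 * (m C 2)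
3·K₂-bound {m} A unique K⊀A with P , occ≤2 ← assignment (small-pattern A K⊀A) = begin
  length A                   ≡⟨ +-identityʳ (length A) ⟨
  length A + 0               ≤⟨ length+slack≤ {P = P} no-slack A unique ⟩
  g m + ∑ A (weight P)       ≤⟨ +-monoʳ-≤ (g m) (∑weight≤ P A occ≤2) ⟩
  g m + 2 * (m C 2)            ∎
  where open ≤-Reasoning

-- Tournaments

all-or-any : ∀ {n} {P Q : Fin n → Set} → (∀ k → P k ⊎ Q k) → (∀ k → P k) ⊎ Σ (Fin n) Q
all-or-any {zero} _ = inj₁ λ ()
all-or-any {suc n} P⊎Q with P⊎Q zero | all-or-any (P⊎Q ∘ suc)
... | inj₂ q | _ = inj₂ (zero , q)
... | inj₁ _ | inj₂ (k , q) = inj₂ (suc k , q)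
... | inj₁ p | inj₁ ps = inj₁ λ { zero → p ; (suc k) → ps k }

module _ {n} (R : Fin n → Fin n → Set) where

  Source Sink : Fin n → Set
  Source w = ∀ k → k ≢ w → R w k
  Sink w = ∀ k → k ≢ w → R k w

  Cycle : Set
  Cycle = Σ (Fin n) λ a → Σ (Fin n) λ b → Σ (Fin n) λ c → R a b × R b c × R c a

  Tournament : Set
  Tournament = ∀ a b → a ≢ b → R a b ⊎ R b a

source-or-cycle : ∀ {n} (R : Fin (suc n) → Fin (suc n) → Set) → Tournament R → Σ _ (Source R) ⊎ Cycle R
source-or-cycle {zero} R _ = inj₁ (zero , λ { zero 0≢0 → ⊥-elim (0≢0 refl) })
source-or-cycle {suc n} R total with source-or-cycle (λ i j → R (suc i) (suc j))
                                       (λ i j i≢j → total (suc i) (suc j) (i≢j ∘ Finₚ.suc-injective))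
... | inj₂ (a , b , c , cycle) = inj₂ (suc a , suc b , suc c , cycle)
... | inj₁ (w , w-source) with total zero (suc w) (λ ())
...   | inj₂ w→0 = inj₁ (suc w , λ { zero _ → w→0 ; (suc k) k≢w → w-source k (k≢w ∘ cong suc) })
...   | inj₁ 0→w with all-or-any (λ k → total zero (suc k) (λ ()))
...     | inj₁ 0→all = inj₁ (zero , λ { zero 0≢0 → ⊥-elim (0≢0 refl) ; (suc k) _ → 0→all k })
...     | inj₂ (k , k→0) with k Finₚ.≟ w
...       | yes refl = inj₁ (suc w , λ { zero _ → k→0 ; (suc k′) k′≢w → w-source k′ (k′≢w ∘ cong suc) })
...       | no k≢w = inj₂ (zero , suc w , suc k , 0→w , w-source k k≢w , k→0)

sink-or-cycle : ∀ {n} (R : Fin (suc n) → Fin (suc n) → Set) → Tournament R → Σ _ (Sink R) ⊎ Cycle R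
sink-or-cycle R total with source-or-cycle (λ a b → R b a) (λ a b a≢b → Sum.swap (total a b a≢b))
... | inj₁ source = inj₁ source
... | inj₂ (a , b , c , b→a , c→b , a→c) = inj₂ (a , c , b , a→c , c→b , b→a)

-- Arc P a b: the pattern chosen for the pair {a, b} is hit exactly by columns with 0 in
-- row a and 1 in row b.
data Arc {m} (P : Assignment m) (a b : Fin m) : Set where
  up   : a Fin.< b → P a b ≡ p01 → Arc P a b
  down : b Fin.< a → P b a ≡ p10 → Arc P a b

arc-total : ∀ {m} (P : Assignment m) → (∀ a b → a Fin.< b → P a b ≡ p10 ⊎ P a b ≡ p01) → Tournament (Arc P)
arc-total P p10∨p01 a b a≢b with Finₚ.<-cmp a b
... | tri≈ _ a≡b _ = ⊥-elim (a≢b a≡b)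
... | tri< a<b _ _ = [ inj₂ ∘ down a<b , inj₁ ∘ up a<b ]′ (p10∨p01 a b a<b)
... | tri> _ _ b<a = [ inj₁ ∘ down b<a , inj₂ ∘ up b<a ]′ (p10∨p01 b a b<a)

arcPair : ∀ {m} {P : Assignment m} {a b} → Arc P a b → Fin m × Fin m
arcPair {a = a} {b} (up _ _) = a , b
arcPair {a = a} {b} (down _ _) = b , a

arcPair-∈ : ∀ {m} {P : Assignment m} {a b} (arc : Arc P a b) → arcPair arc ∈ pairs m
arcPair-∈ (up a<b _) = ∈-pairs a<b
arcPair-∈ (down b<a _) = ∈-pairs b<a

arc-hit : ∀ {m} {P : Assignment m} {a b} (arc : Arc P a b) x →
          lookup x a ≡ 0F → lookup x b ≡ 1F → hitsAt P x (arcPair arc) ≡ 1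
arc-hit (up _ Pab≡p01) x xa≡0 xb≡1 rewrite Pab≡p01 | xa≡0 | xb≡1 = refl
arc-hit (down _ Pba≡p10) x xa≡0 xb≡1 rewrite Pba≡p10 | xa≡0 | xb≡1 = refl

arc-hit≤1 : ∀ {m} {P : Assignment m} {a b} (arc : Arc P a b) x → hitsAt P x (arcPair arc) ≤ 1
arc-hit≤1 {a = a} {b} (up _ Pab≡p01) x rewrite Pab≡p01 = 𝟙≤1 (rows a b x ≟₂ c01)
arc-hit≤1 {a = a} {b} (down _ Pba≡p10) x rewrite Pba≡p10 = 𝟙≤1 (rows b a x ≟₂ c10)

arc-hit⁻ : ∀ {m} {P : Assignment m} {a b} (arc : Arc P a b) x →
           0 < hitsAt P x (arcPair arc) → lookup x a ≡ 0F × lookup x b ≡ 1F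
arc-hit⁻ {a = a} {b} (up _ Pab≡p01) x hit rewrite Pab≡p01
  with xa≡0 , xb≡1,[]≡ ← Vec.∷-injective (𝟙-positive (rows a b x ≟₂ c01) hit) = xa≡0 , Vec.∷-injectiveˡ xb≡1,[]≡
arc-hit⁻ {a = a} {b} (down _ Pba≡p10) x hit rewrite Pba≡p10
  with xb≡1 , xa≡0,[]≡ ← Vec.∷-injective (𝟙-positive (rows b a x ≟₂ c10) hit) = Vec.∷-injectiveˡ xa≡0,[]≡ , xb≡1

arc-weight : ∀ {m} {P : Assignment m} {a b} (arc : Arc P a b) x →
             lookup x a ≡ 0F → lookup x b ≡ 1F → 0 < weight P x
arc-weight {m} {P} arc x xa≡0 xb≡1 =
  subst (_≤ weight P x) (arc-hit arc x xa≡0 xb≡1) (∑-member (hitsAt P x) (arcPair-∈ arc))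

two-arcs-weight : ∀ {m} {P : Assignment m} {a b c d} (arc₁ : Arc P a b) (arc₂ : Arc P c d) x →
                  lookup x a ≡ 0F → lookup x b ≡ 1F → lookup x c ≡ 0F → lookup x d ≡ 1F →
                  ¬ (a ≡ c × b ≡ d) → 2 ≤ weight P x
two-arcs-weight {m} {P} arc₁ arc₂ x xa≡0 xb≡1 xc≡0 xd≡1 different =
  subst (_≤ weight P x) (cong₂ _+_ (arc-hit arc₁ x xa≡0 xb≡1) (arc-hit arc₂ x xc≡0 xd≡1))
        (∑-pair (hitsAt P x) (pairs-unique m) (arcPair-∈ arc₁) (arcPair-∈ arc₂) (distinct arc₁ arc₂))
  where
  0≢1 : ∀ {i j} → lookup x i ≡ 1F → lookup x j ≡ 0F → i ≢ j
  0≢1 xi≡1 xj≡0 refl with trans (sym xi≡1) xj≡0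
  ... | ()
  distinct : (arc₁ : Arc P _ _) (arc₂ : Arc P _ _) → arcPair arc₁ ≢ arcPair arc₂
  distinct (up _ _) (up _ _) eq = different (cong proj₁ eq , cong proj₂ eq)
  distinct (up _ _) (down _ _) eq = 0≢1 xb≡1 xc≡0 (cong proj₂ eq)
  distinct (down _ _) (up _ _) eq = 0≢1 xb≡1 xc≡0 (cong proj₁ eq)
  distinct (down _ _) (down _ _) eq = different (cong proj₂ eq , cong proj₁ eq)

arc-irrefl : ∀ {m} {P : Assignment m} {a} → Arc P a a → ⊥
arc-irrefl (up a<a _) = Finₚ.<-irrefl refl a<a
arc-irrefl (down a<a _) = Finₚ.<-irrefl refl a<a

arc-asym : ∀ {m} {P : Assignment m} {a b} → Arc P a b → Arc P b a → ⊥
arc-asym (up a<b _) (up b<a _) = Finₚ.<-asym a<b b<a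
arc-asym (up _ Pab≡p01) (down _ Pab≡p10) with trans (sym Pab≡p01) Pab≡p10
... | ()
arc-asym (down _ Pba≡p10) (up _ Pba≡p01) with trans (sym Pba≡p01) Pba≡p10
... | ()
arc-asym (down b<a _) (down a<b _) = Finₚ.<-asym a<b b<a

lower-arc : ∀ {m} {P : Assignment (suc m)} {a b} → Arc P (suc a) (suc b) → Arc (lower P) a b
lower-arc (up (s<s a<b) Pab≡p01) = up a<b Pab≡p01
lower-arc (down (s<s b<a) Pba≡p10) = down b<a Pba≡p10

thin-slack : ∀ {m} (P : Assignment m) {a b} → a Fin.< b → P a b ≡ pI₂ → Σ ℕ λ s → Slack m P s × 2 ^ (m ∸ 2) ≤ s
thin-slack {suc m} P {zero} {suc k} _ Pab≡I₂ = 2 ^ (m ∸ 1) , slack-∷ no-slack (thin-top k Pab≡I₂) , ≤-refl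
thin-slack {suc m} P {suc a} {suc b} (s<s a<b) Pab≡I₂ with s , slack , 2^≤s ← thin-slack (lower P) a<b Pab≡I₂ =
  s + s + 0 , slack-∷ slack no-top-slack , doubled m 2^≤s
  where
  doubled : ∀ m {s} → 2 ^ (m ∸ 2) ≤ s → 2 ^ (suc m ∸ 2) ≤ s + s + 0
  doubled zero 1≤s = ≤-trans 1≤s (≤-trans (m≤m+n _ _) (m≤m+n _ 0))
  doubled (suc zero) 1≤s = ≤-trans 1≤s (≤-trans (m≤m+n _ _) (m≤m+n _ 0))
  doubled (suc (suc m)) {s} 2^≤s = begin
    2 ^ m + (2 ^ m + 0)   ≡⟨ cong (2 ^ m +_) (+-identityʳ (2 ^ m)) ⟩
    2 ^ m + 2 ^ m         ≤⟨ +-mono-≤ 2^≤s 2^≤s ⟩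
    s + s                 ≡⟨ +-identityʳ (s + s) ⟨
    s + s + 0             ∎
    where open ≤-Reasoning

entry₀₁ : ∀ {m} → Fin m → Fin m → Fin m → Fin 3
entry₀₁ j k l with l Finₚ.≟ j | l Finₚ.≟ k
... | yes _ | _ = 0F
... | no _ | yes _ = 1F
... | no _ | no _ = 2F

column₀₁ : ∀ {m} → Fin m → Fin m → Col m
column₀₁ j k = tabulate (entry₀₁ j k)

cycle-through-top : ∀ {m} {P : Assignment (suc m)} {j k} →
                    Arc P zero (suc j) → Arc (lower P) j k → Arc P (suc k) zero → TopSlack P 1
cycle-through-top {P = P} {j} {k} (up _ P0j≡p01) jk (down _ P0k≡p10) =
  free-top (column₀₁ j k) (∈-box (topFree P) free-entries)
    (arc-weight jk (column₀₁ j k) (trans (Vec.lookup∘tabulate (entry₀₁ j k) j) at-j)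
                                  (trans (Vec.lookup∘tabulate (entry₀₁ j k) k) at-k))
  where
  j≢k : j ≢ k
  j≢k refl = arc-irrefl jk
  at-j : entry₀₁ j k j ≡ 0F
  at-j with j Finₚ.≟ j
  ... | yes _ = refl
  ... | no j≢j = ⊥-elim (j≢j refl)
  at-k : entry₀₁ j k k ≡ 1F
  at-k with k Finₚ.≟ j | k Finₚ.≟ k
  ... | yes k≡j | _ = ⊥-elim (j≢k (sym k≡j))
  ... | no _ | yes _ = refl
  ... | no _ | no k≢k = ⊥-elim (k≢k refl)
  free-entries : ∀ l → lookup (column₀₁ j k) l ∈ topFree P l
  free-entries l rewrite Vec.lookup∘tabulate (entry₀₁ j k) l with l Finₚ.≟ j | l Finₚ.≟ k
  ... | yes refl | _ rewrite P0j≡p01 = there (here refl)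
  ... | no _ | yes refl rewrite P0k≡p10 = there (here refl)
  ... | no _ | no _ = 2F∈free (P zero (suc l))

cycle-slack : ∀ {m} (P : Assignment m) {a b c} → Arc P a b → Arc P b c → Arc P c a → Σ ℕ λ s → Slack m P s × 0 < s
cycle-slack P {zero} {zero} ab _ _ = ⊥-elim (arc-irrefl ab)
cycle-slack P {_} {zero} {zero} _ bc _ = ⊥-elim (arc-irrefl bc)
cycle-slack P {zero} {_} {zero} _ _ ca = ⊥-elim (arc-irrefl ca)
cycle-slack P {zero} {suc _} {suc _} ab bc ca = 1 , slack-∷ no-slack (cycle-through-top ab (lower-arc bc) ca) , s≤s z≤n
cycle-slack P {suc _} {zero} {suc _} ab bc ca = 1 , slack-∷ no-slack (cycle-through-top bc (lower-arc ca) ab) , s≤s z≤n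
cycle-slack P {suc _} {suc _} {zero} ab bc ca = 1 , slack-∷ no-slack (cycle-through-top ca (lower-arc ab) bc) , s≤s z≤n
cycle-slack P {suc _} {suc _} {suc _} ab bc ca
  with s , slack , 0<s ← cycle-slack (lower P) (lower-arc ab) (lower-arc bc) (lower-arc ca) =
  s + s + 0 , slack-∷ slack no-top-slack , ≤-trans 0<s (≤-trans (m≤m+n s s) (m≤m+n _ 0))

heavy-column-bound : ∀ {m} (P : Assignment m) {A x} → Unique A → x ∈ A → 2 ≤ weight P x →
                     length A < g m + ∑ A (weight P)
heavy-column-bound {m} P {A} unique x∈A heavy = begin-strict
  length A                          <⟨ length<zeros+∑ (weight P) x∈A heavy ⟩
  length Z + ∑ A (weight P)         ≤⟨ +-monoˡ-≤ (∑ A (weight P)) Z≤g ⟩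
  g m + ∑ A (weight P)              ∎
  where
  open ≤-Reasoning
  Z = zeros (weight P) A
  Z≤g : length Z ≤ g m
  Z≤g = begin
    length Z                 ≡⟨ +-identityʳ (length Z) ⟨
    length Z + 0             ≤⟨ length+slack≤ {P = P} no-slack Z (Unique.filter⁺ _ unique) ⟩
    g m + ∑ Z (weight P)     ≡⟨ cong (g m +_) (∑-zero Z λ x∈Z → proj₂ (∈-filter⁻ (λ x → weight P x ≟ 0) {xs = A} x∈Z)) ⟩
    g m + 0                  ≡⟨ +-identityʳ (g m) ⟩
    g m                      ∎

cycle-bound : ∀ {m} (P : Assignment m) {A} → Unique A → Cycle (Arc P) → length A < g m + ∑ A (weight P)
cycle-bound {m} P {A} unique (_ , _ , _ , ab , bc , ca) with s , slack , 0<s ← cycle-slack P ab bc ca =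
  subst (_≤ g m + ∑ A (weight P)) (+-comm (length A) 1)
        (≤-trans (+-monoʳ-≤ (length A) 0<s) (length+slack≤ slack A unique))

module _ {m} {P : Assignment m} {w₁ w₂}
         (source : Source (Arc P) w₁) (sink : Sink (Arc P) w₂) (w₁≢w₂ : w₁ ≢ w₂) where

  private
    w₁→w₂ : Arc P w₁ w₂
    w₁→w₂ = source w₂ (w₁≢w₂ ∘ sym)

  light-column-entry : ∀ x → lookup x w₁ ≡ 0F → lookup x w₂ ≡ 1F → weight P x ≤ 1 →
                       ∀ k → k ≢ w₁ → k ≢ w₂ → lookup x k ≡ 2F
  light-column-entry x xw₁≡0 xw₂≡1 light k k≢w₁ k≢w₂ with lookup x k in xk≡
  ... | 0F = ⊥-elim (<⇒≱ (two-arcs-weight (sink k k≢w₂) w₁→w₂ x xk≡ xw₂≡1 xw₁≡0 xw₂≡1 (k≢w₁ ∘ proj₁)) light)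
  ... | 1F = ⊥-elim (<⇒≱ (two-arcs-weight w₁→w₂ (source k k≢w₁) x xw₁≡0 xw₂≡1 xw₁≡0 xk≡ (k≢w₂ ∘ sym ∘ proj₂)) light)
  ... | 2F = refl

  light-columns-equal : ∀ x y → lookup x w₁ ≡ 0F → lookup x w₂ ≡ 1F → weight P x ≤ 1 →
                        lookup y w₁ ≡ 0F → lookup y w₂ ≡ 1F → weight P y ≤ 1 → x ≡ y
  light-columns-equal x y xw₁≡0 xw₂≡1 x-light yw₁≡0 yw₂≡1 y-light = lookup-ext agree
    where
    agree : ∀ l → lookup x l ≡ lookup y l
    agree l with l Finₚ.≟ w₁ | l Finₚ.≟ w₂
    ... | yes refl | _ = trans xw₁≡0 (sym yw₁≡0)
    ... | no _ | yes refl = trans xw₂≡1 (sym yw₂≡1)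
    ... | no l≢w₁ | no l≢w₂ = trans (light-column-entry x xw₁≡0 xw₂≡1 x-light l l≢w₁ l≢w₂)
                                    (sym (light-column-entry y yw₁≡0 yw₂≡1 y-light l l≢w₁ l≢w₂))

  -- Only one column without a second arc can show 0 over 1 on the arc from w₁ to w₂.
  transitive-bound : ∀ {A} → Unique A → (∀ a b → a Fin.< b → 2 ≤ occ (P a b) a b A) →
                     length A < g m + ∑ A (weight P)
  transitive-bound {A} unique occ≥2 with any? (λ x → 2 ≤? weight P x) A
  ... | yes heavy with x , x∈A , 2≤wx ← find heavy = heavy-column-bound P unique x∈A 2≤wx
  ... | no no-heavy = ⊥-elim (<⇒≱ occ≥2-at-arc occ≤1-at-arc)
    where
    ab = arcPair w₁→w₂
    occ≥2-at-arc : 2 ≤ occAt P A ab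
    occ≥2-at-arc = occ≥2 (proj₁ ab) (proj₂ ab) (∈-pairs⁻ (arcPair-∈ w₁→w₂))
    light : ∀ {x} → x ∈ A → weight P x ≤ 1
    light x∈A = ≤-pred (≰⇒> λ 2≤wx → no-heavy (Any.map (λ { refl → 2≤wx }) x∈A))
    occ≤1-at-arc : occAt P A ab ≤ 1
    occ≤1-at-arc = ∑≤1 (λ x → hitsAt P x ab) unique (arc-hit≤1 w₁→w₂) λ {x} {y} x∈A y∈A x-hit y-hit →
      let xw₁≡0 , xw₂≡1 = arc-hit⁻ w₁→w₂ x x-hit
          yw₁≡0 , yw₂≡1 = arc-hit⁻ w₁→w₂ y y-hit
      in light-columns-equal x y xw₁≡0 xw₂≡1 (light x∈A) yw₁≡0 yw₂≡1 (light y∈A)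

tournament-bound : ∀ {m} (P : Assignment m) {A} → 2 ≤ m → Unique A →
                   (∀ a b → a Fin.< b → P a b ≡ p10 ⊎ P a b ≡ p01) →
                   (∀ a b → a Fin.< b → 2 ≤ occ (P a b) a b A) → length A < g m + ∑ A (weight P)
tournament-bound {suc zero} P (s≤s ()) _ _ _
tournament-bound {suc (suc m)} P _ unique p10∨p01 occ≥2
  with source-or-cycle (Arc P) (arc-total P p10∨p01) | sink-or-cycle (Arc P) (arc-total P p10∨p01)
... | inj₂ cycle | _ = cycle-bound P unique cycle
... | inj₁ _ | inj₂ cycle = cycle-bound P unique cycle
... | inj₁ (w₁ , source) | inj₁ (w₂ , sink) = transitive-bound source sink w₁≢w₂ unique occ≥2
  where
  other : Fin (suc (suc m)) → Fin (suc (suc m))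
  other zero = suc zero
  other (suc _) = zero
  other≢ : ∀ w → other w ≢ w
  other≢ zero ()
  other≢ (suc _) ()
  w₁≢w₂ : w₁ ≢ w₂
  w₁≢w₂ refl = arc-asym (source (other w₁) (other≢ w₁)) (sink (other w₁) (other≢ w₁))

-- 00 and 11 are only chosen when they occur at most once, so that if every pair occurs
-- twice the chosen patterns are arcs of a tournament.
capacity : ℕ → Pattern → ℕ
capacity β p00 = 1
capacity β p10 = 2
capacity β p01 = 2
capacity β p11 = 1
capacity β pI₂ = 2 * β

capacity≤2β : ∀ {β} → 1 ≤ β → ∀ p → capacity β p ≤ 2 * β
capacity≤2β 1≤β p00 = ≤-trans 1≤β (m≤m+n _ _)
capacity≤2β 1≤β p10 = *-monoʳ-≤ 2 1≤β
capacity≤2β 1≤β p01 = *-monoʳ-≤ 2 1≤β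
capacity≤2β 1≤β p11 = ≤-trans 1≤β (m≤m+n _ _)
capacity≤2β 1≤β pI₂ = ≤-refl

_≟pI₂ : ∀ p → Dec (p ≡ pI₂)
p00 ≟pI₂ = no λ ()
p10 ≟pI₂ = no λ ()
p01 ≟pI₂ = no λ ()
p11 ≟pI₂ = no λ ()
pI₂ ≟pI₂ = yes refl

thin-arith : ∀ {L G C β M s} → L + s ≤ G + 2 * β * C → β * M ≤ s → 2 * C ≤ M → 1 ≤ M → 1 ≤ β → L < G + 2 * C
thin-arith {L} {G} {C} {suc β′} {M} {s} L+s≤ βM≤s 2C≤M 1≤M _ = +-cancelʳ-≤ (β′ * M) (suc L) (G + 2 * C) (begin
  suc L + β′ * M            ≡⟨ +-suc L (β′ * M) ⟨
  L + (1 + β′ * M)          ≤⟨ +-monoʳ-≤ L (+-monoˡ-≤ (β′ * M) 1≤M) ⟩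
  L + suc β′ * M            ≤⟨ +-monoʳ-≤ L βM≤s ⟩
  L + s                     ≤⟨ L+s≤ ⟩
  G + 2 * suc β′ * C        ≡⟨ split-off-2C G β′ C ⟩
  G + 2 * C + β′ * (2 * C)  ≤⟨ +-monoʳ-≤ (G + 2 * C) (*-monoʳ-≤ β′ 2C≤M) ⟩
  G + 2 * C + β′ * M        ∎)
  where
  open ≤-Reasoning
  split-off-2C : ∀ G β′ C → G + 2 * suc β′ * C ≡ G + 2 * C + β′ * (2 * C)
  split-off-2C = solve-∀

thin-pattern-bound : ∀ {m} (P : Assignment m) {A β r s} → 2 ≤ m → 1 ≤ β → β * (m * m) ≤ 2 ^ (m ∸ 2) → Unique A →
                     (∀ r s → r Fin.< s → occ (P r s) r s A ≤ 2 * β) → r Fin.< s → P r s ≡ pI₂ →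
                     length A < g m + 2 * (m C 2)
thin-pattern-bound {m} P {A} 2≤m 1≤β β-small unique occ≤2β r<s Prs≡I₂
  with σ , slack , 2^≤σ ← thin-slack P r<s Prs≡I₂ =
  thin-arith (≤-trans (length+slack≤ slack A unique) (+-monoʳ-≤ (g m) (∑weight≤ P A occ≤2β)))
             (≤-trans β-small 2^≤σ) (2*C2≤m*m m) (*-mono-≤ 1≤m 1≤m) 1≤β
  where
  1≤m = ≤-trans (s≤s z≤n) 2≤m

capacity-not-pI₂ : ∀ {β} p → p ≢ pI₂ → capacity β p ≤ 2
capacity-not-pI₂ p00 _ = s≤s z≤n
capacity-not-pI₂ p10 _ = ≤-refl
capacity-not-pI₂ p01 _ = ≤-refl
capacity-not-pI₂ p11 _ = s≤s z≤n
capacity-not-pI₂ pI₂ p≢I₂ = ⊥-elim (p≢I₂ refl)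

capacity-two : ∀ {β} p → p ≢ pI₂ → 2 ≤ capacity β p → p ≡ p10 ⊎ p ≡ p01
capacity-two p10 _ _ = inj₁ refl
capacity-two p01 _ _ = inj₂ refl
capacity-two p00 _ (s≤s ())
capacity-two p11 _ (s≤s ())
capacity-two pI₂ p≢I₂ _ = ⊥-elim (p≢I₂ refl)

no-thin-pattern-bound : ∀ {m} (P : Assignment m) {A β} → 2 ≤ m → Unique A →
                        (∀ r s → r Fin.< s → occ (P r s) r s A ≤ capacity β (P r s)) →
                        (∀ r s → r Fin.< s → P r s ≢ pI₂) → length A < g m + 2 * (m C 2)
no-thin-pattern-bound {m} P {A} 2≤m unique occ≤cap no-I₂ =
  by-cases (Finₚ.any? λ r → Finₚ.any? λ s → r Finₚ.<? s ×-dec (occ (P r s) r s A ≤? 1))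
  where
  open ≤-Reasoning
  occ≤2 : ∀ r s → r Fin.< s → occ (P r s) r s A ≤ 2
  occ≤2 r s r<s = ≤-trans (occ≤cap r s r<s) (capacity-not-pI₂ (P r s) (no-I₂ r s r<s))
  by-cases : Dec (∃ λ r → ∃ λ s → r Fin.< s × occ (P r s) r s A ≤ 1) → length A < g m + 2 * (m C 2)
  by-cases (yes (r , s , r<s , occ≤1)) = begin-strict
    length A               ≡⟨ +-identityʳ (length A) ⟨
    length A + 0           ≤⟨ length+slack≤ {P = P} no-slack A unique ⟩
    g m + ∑ A (weight P)   <⟨ +-monoʳ-< (g m) (∑weight< P A occ≤2 r<s (s≤s occ≤1)) ⟩
    g m + 2 * (m C 2)      ∎
  by-cases (no none≤1) = begin-strict
    length A               <⟨ tournament-bound P 2≤m unique p10∨p01 occ≥2 ⟩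
    g m + ∑ A (weight P)   ≤⟨ +-monoʳ-≤ (g m) (∑weight≤ P A occ≤2) ⟩
    g m + 2 * (m C 2)      ∎
    where
    occ≥2 : ∀ r s → r Fin.< s → 2 ≤ occ (P r s) r s A
    occ≥2 r s r<s = ≰⇒> (λ occ≤1 → none≤1 (r , s , r<s , occ≤1))
    p10∨p01 : ∀ r s → r Fin.< s → P r s ≡ p10 ⊎ P r s ≡ p01
    p10∨p01 r s r<s = capacity-two (P r s) (no-I₂ r s r<s) (≤-trans (occ≥2 r s r<s) (occ≤cap r s r<s))

module _ {a b c d : ℕ} (b⊓c≡3 : b ⊓ c ≡ 3) (a⊔d≤2 : a ⊔ d ≤ 2) where

  private
    β = b ⊔ c ∸ 1

  -- One of b, c is 3 and the other is b ⊔ c; reading rows r, s in the opposite order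
  -- exchanges the roles of 10 and 01.
  large-occ-bounded : ∀ {m} {r s : Fin m} (A : List (Col m)) → ¬ (Fabcd a b c d ≺ A) → r ≢ s →
                      2 ≤ occ p00 r s A → 3 ≤ occ p10 r s A → 3 ≤ occ p01 r s A → 2 ≤ occ p11 r s A →
                      occ p10 r s A ≤ β × occ p01 r s A ≤ β
  large-occ-bounded {r = r} {s} A F⊀A r≢s 2≤n₀₀ 3≤n₁₀ 3≤n₀₁ 2≤n₁₁ = by-order (≤-total b c)
    where
    below-max : ∀ {n} → ¬ (b ⊔ c ≤ n) → n ≤ β
    below-max B≰n = ∸-monoˡ-≤ 1 (≰⇒> B≰n)
    a≤n₀₀ : a ≤ occ p00 r s A
    a≤n₀₀ = ≤-trans (≤-trans (m≤m⊔n a d) a⊔d≤2) 2≤n₀₀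
    d≤n₁₁ : d ≤ occ p11 r s A
    d≤n₁₁ = ≤-trans (≤-trans (m≤n⊔m a d) a⊔d≤2) 2≤n₁₁
    direct : b ≤ occ p10 r s A → c ≤ occ p01 r s A → Fabcd a b c d ≺ A
    direct b≤ c≤ = occ⇒Fabcd≺ A r≢s a≤n₀₀ b≤ c≤ d≤n₁₁
    swapped : b ≤ occ p01 r s A → c ≤ occ p10 r s A → Fabcd a b c d ≺ A
    swapped b≤ c≤ = occ⇒Fabcd≺ A (r≢s ∘ sym)
      (subst (a ≤_) (sym (occ-mirror p00 r s A)) a≤n₀₀) (subst (b ≤_) (sym (occ-mirror p01 r s A)) b≤)
      (subst (c ≤_) (sym (occ-mirror p10 r s A)) c≤) (subst (d ≤_) (sym (occ-mirror p11 r s A)) d≤n₁₁)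
    by-order : b ≤ c ⊎ c ≤ b → occ p10 r s A ≤ β × occ p01 r s A ≤ β
    by-order (inj₁ b≤c) =
      below-max (λ B≤n₁₀ → F⊀A (swapped (subst (_≤ _) (sym b≡3) 3≤n₀₁) (subst (_≤ _) (m≤n⇒m⊔n≡n b≤c) B≤n₁₀))) ,
      below-max (λ B≤n₀₁ → F⊀A (direct (subst (_≤ _) (sym b≡3) 3≤n₁₀) (subst (_≤ _) (m≤n⇒m⊔n≡n b≤c) B≤n₀₁)))
      where b≡3 = trans (sym (m≤n⇒m⊓n≡m b≤c)) b⊓c≡3
    by-order (inj₂ c≤b) =
      below-max (λ B≤n₁₀ → F⊀A (direct (subst (_≤ _) (m≥n⇒m⊔n≡m c≤b) B≤n₁₀) (subst (_≤ _) (sym c≡3) 3≤n₀₁))) ,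
      below-max (λ B≤n₀₁ → F⊀A (swapped (subst (_≤ _) (m≥n⇒m⊔n≡m c≤b) B≤n₀₁) (subst (_≤ _) (sym c≡3) 3≤n₁₀)))
      where c≡3 = trans (sym (m≥n⇒m⊓n≡n c≤b)) b⊓c≡3

  capacity-pattern : ∀ {m} (A : List (Col m)) → ¬ (Fabcd a b c d ≺ A) →
                     ∀ r s → r Fin.< s → Σ Pattern λ p → occ p r s A ≤ capacity β p
  capacity-pattern A F⊀A r s r<s
    with occ p00 r s A ≤? 1 | occ p11 r s A ≤? 1 | occ p10 r s A ≤? 2 | occ p01 r s A ≤? 2
  ... | yes n≤1 | _ | _ | _ = p00 , n≤1
  ... | no _ | yes n≤1 | _ | _ = p11 , n≤1
  ... | no _ | no _ | yes n≤2 | _ = p10 , n≤2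
  ... | no _ | no _ | no _ | yes n≤2 = p01 , n≤2
  ... | no n₀₀≰1 | no n₁₁≰1 | no n₁₀≰2 | no n₀₁≰2
    with n₁₀≤β , n₀₁≤β ← large-occ-bounded A F⊀A (Finₚ.<⇒≢ r<s) (≰⇒> n₀₀≰1) (≰⇒> n₁₀≰2) (≰⇒> n₀₁≰2) (≰⇒> n₁₁≰1)
    = pI₂ , (begin
      occ pI₂ r s A                   ≡⟨ ∑-distrib-+ A (λ x → hits p10 (rows r s x)) (λ x → hits p01 (rows r s x)) ⟩
      occ p10 r s A + occ p01 r s A   ≤⟨ +-mono-≤ n₁₀≤β n₀₁≤β ⟩
      β + β                           ≡⟨ cong (β +_) (+-identityʳ β) ⟨
      2 * β                           ∎)
    where open ≤-Reasoning

  Fabcd-bound : ∀ {m} (A : List (Col m)) → 2 ≤ m → β * (m * m) ≤ 2 ^ (m ∸ 2) → Unique A →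
                ¬ (Fabcd a b c d ≺ A) → length A < g m + 2 * (m C 2)
  Fabcd-bound {m} A 2≤m β-small unique F⊀A
    with P , occ≤cap ← assignment (capacity-pattern A F⊀A)
    with Finₚ.any? (λ r → Finₚ.any? (λ s → r Finₚ.<? s ×-dec (P r s ≟pI₂)))
  ... | yes (r , s , r<s , Prs≡I₂) =
    thin-pattern-bound P 2≤m 1≤β β-small unique
      (λ r s r<s → ≤-trans (occ≤cap r s r<s) (capacity≤2β 1≤β (P r s))) r<s Prs≡I₂
    where
    1≤β : 1 ≤ β
    1≤β = ∸-monoˡ-≤ 1 (≤-trans (s≤s (s≤s z≤n)) (subst (_≤ b ⊔ c) b⊓c≡3 (m⊓n≤m⊔n b c)))
  ... | no no-I₂ = no-thin-pattern-bound P 2≤m unique occ≤cap (λ r s r<s Prs≡I₂ → no-I₂ (r , s , r<s , Prs≡I₂))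

-- Extremal matrices

prefix-unique : ∀ {m} h {L : List (Col m)} → Unique L → Unique (map (h ∷_) L)
prefix-unique h = Unique.map⁺ Vec.∷-injectiveʳ

prefix-disjoint : ∀ {m} {h h′ : Fin 3} {L L′ : List (Col m)} → h ≢ h′ →
                  Disjoint (map (h ∷_) L) (map (h′ ∷_) L′)
prefix-disjoint {h = h} {h′} h≢h′ (x∈ , x∈′) with _ , _ , refl ← ∈-map⁻ (h ∷_) x∈
                                              with _ , _ , eq ← ∈-map⁻ (h′ ∷_) x∈′ = h≢h′ (Vec.∷-injectiveˡ eq)

by-top-unique : ∀ {m} {h₁ h₂ h₃ : Fin 3} {L₁ L₂ L₃ : List (Col m)} → h₁ ≢ h₂ → h₁ ≢ h₃ → h₂ ≢ h₃ →
                Unique L₁ → Unique L₂ → Unique L₃ →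
                Unique (map (h₁ ∷_) L₁ ++ map (h₂ ∷_) L₂ ++ map (h₃ ∷_) L₃)
by-top-unique {h₁ = h₁} {h₂} {h₃} {L₂ = L₂} h₁≢h₂ h₁≢h₃ h₂≢h₃ u₁ u₂ u₃ =
  Unique.++⁺ (prefix-unique h₁ u₁) (Unique.++⁺ (prefix-unique h₂ u₂) (prefix-unique h₃ u₃) (prefix-disjoint h₂≢h₃))
    λ (x∈₁ , x∈₂₃) → [ (λ x∈₂ → prefix-disjoint h₁≢h₂ (x∈₁ , x∈₂)) , (λ x∈₃ → prefix-disjoint h₁≢h₃ (x∈₁ , x∈₃)) ]′
                       (∈-++⁻ (map (h₂ ∷_) L₂) x∈₂₃)

onesAt : ∀ {m} → Fin m → List (Col m) → ℕ
onesAt s L = ∑[ y ∈ L ] 𝟙 (lookup y s Finₚ.≟ 1F)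

onesAt-top : ∀ {m} {h} (L : List (Col m)) → h ≢ 1F → onesAt zero (map (h ∷_) L) ≡ 0
onesAt-top {h = h} L h≢1 = trans (∑-map (h ∷_) L _) (∑-zero L λ _ → 𝟙-no (h Finₚ.≟ 1F) h≢1)

onesAt-tail : ∀ {m} h (s : Fin m) L → onesAt (suc s) (map (h ∷_) L) ≡ onesAt s L
onesAt-tail h s L = ∑-map (h ∷_) L _

Has Lacks : ∀ {m} → Fin 3 → Col m → Set
Has v x = Σ _ λ k → lookup x k ≡ v
Lacks v x = ∀ k → lookup x k ≢ v

∈-prefix : ∀ {m} (R : Col (suc m) → Set) h {L : List (Col m)} →
           (∀ {y} → y ∈ L → R (h ∷ y)) → ∀ {x} → x ∈ map (h ∷_) L → R x
∈-prefix R h R-L x∈ with _ , y∈ , refl ← ∈-map⁻ (h ∷_) x∈ = R-L y∈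

lacks-∷ : ∀ {m} {v h} {y : Col m} → h ≢ v → Lacks v y → Lacks v (h ∷ y)
lacks-∷ h≢v _ zero = h≢v
lacks-∷ _ y-lacks (suc k) = y-lacks k

has-∷ : ∀ {m} {v h} {y : Col m} → Has v y → Has v (h ∷ y)
has-∷ (k , yk≡v) = suc k , yk≡v

lacks-replicate : ∀ {m} c {v} → c ≢ v → Lacks v (replicate m c)
lacks-replicate c c≢v k rewrite Vec.lookup-replicate k c = c≢v

∷-prefix-unique : ∀ {m} {v h} {y : Col m} {L} → v ≢ h → Unique L → Unique ((v ∷ y) ∷ map (h ∷_) L)
∷-prefix-unique {v = v} {h} {y} v≢h unique =
  All.tabulate (λ x∈ → ∈-prefix ((v ∷ y) ≢_) h (λ _ eq → v≢h (Vec.∷-injectiveˡ eq)) x∈) ∷ prefix-unique h unique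

+≡0 : ∀ {a b} → a ≡ 0 → b ≡ 0 → a + b ≡ 0
+≡0 refl refl = refl

+≡0-left : ∀ {a b c} → a ≡ 0 → b ≡ c → a + b ≡ c
+≡0-left refl b≡c = b≡c

HitsBelow1 : Pattern → Set
HitsBelow1 p = ∀ u v → hits p (u ∷ v ∷ []) ≤ 𝟙 (v Finₚ.≟ 1F)

𝟙-below : ∀ u v h w → 𝟙 ((u ∷ v ∷ []) ≟₂ (h ∷ w ∷ [])) ≤ 𝟙 (v Finₚ.≟ w)
𝟙-below u v h w =
  𝟙-mono (λ eq → Vec.∷-injectiveˡ (Vec.∷-injectiveʳ eq)) ((u ∷ v ∷ []) ≟₂ (h ∷ w ∷ [])) (v Finₚ.≟ w)

p01-below1 : HitsBelow1 p01
p01-below1 u v = 𝟙-below u v 0F 1F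

p11-below1 : HitsBelow1 p11
p11-below1 u v = 𝟙-below u v 1F 1F

hits-lacking-1 : ∀ p → HitsBelow1 p → ∀ u {v} → v ≢ 1F → hits p (u ∷ v ∷ []) ≡ 0
hits-lacking-1 p below1 u {v} v≢1 = n≤0⇒n≡0 (≤-trans (below1 u v) (≤-reflexive (𝟙-no (v Finₚ.≟ 1F) v≢1)))

occ-lacking-1 : ∀ {m} p → HitsBelow1 p → ∀ (r s : Fin m) {L} → (∀ {y} → y ∈ L → Lacks 1F y) → occ p r s L ≡ 0
occ-lacking-1 p below1 r s {L} lacking = ∑-zero L λ {y} y∈L → hits-lacking-1 p below1 (lookup y r) (lacking y∈L s)

onesAt-lacking-1 : ∀ {m} (s : Fin m) {L} → (∀ {y} → y ∈ L → Lacks 1F y) → onesAt s L ≡ 0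
onesAt-lacking-1 s {L} lacking = ∑-zero L λ {y} y∈L → 𝟙-no (lookup y s Finₚ.≟ 1F) (lacking y∈L s)

occ-top-missed : ∀ {m} p h (s : Fin m) L → (∀ v → hits p (h ∷ v ∷ []) ≡ 0) → occ p zero (suc s) (map (h ∷_) L) ≡ 0
occ-top-missed p h s L missed = trans (occ-top p h s L) (∑-zero L λ {y} _ → missed (lookup y s))

over02 : ∀ m → List (Col m)
over02 zero = [] ∷ []
over02 (suc m) = map (0F ∷_) (over02 m) ++ map (2F ∷_) (over02 m)

over02-lacks-1 : ∀ {m} {x : Col m} → x ∈ over02 m → Lacks 1F x
over02-lacks-1 {suc m} x∈ with ∈-++⁻ (map (0F ∷_) (over02 m)) x∈
... | inj₁ x∈₀ = ∈-prefix (Lacks 1F) 0F (λ y∈ → lacks-∷ (λ ()) (over02-lacks-1 y∈)) x∈₀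
... | inj₂ x∈₂ = ∈-prefix (Lacks 1F) 2F (λ y∈ → lacks-∷ (λ ()) (over02-lacks-1 y∈)) x∈₂

over02-unique : ∀ m → Unique (over02 m)
over02-unique zero = [] ∷ []
over02-unique (suc m) =
  Unique.++⁺ (prefix-unique 0F (over02-unique m)) (prefix-unique 2F (over02-unique m)) (prefix-disjoint λ ())

length-over02 : ∀ m → length (over02 m) ≡ 2 ^ m
length-over02 zero = refl
length-over02 (suc m) = begin
  length (map (0F ∷_) (over02 m) ++ map (2F ∷_) (over02 m))         ≡⟨ length-++ (map (0F ∷_) (over02 m)) ⟩
  length (map (0F ∷_) (over02 m)) + length (map (2F ∷_) (over02 m)) ≡⟨ cong₂ _+_ (length-map _ (over02 m))
                                                                                  (length-map _ (over02 m)) ⟩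
  length (over02 m) + length (over02 m)                             ≡⟨ cong (λ n → n + n) (length-over02 m) ⟩
  2 ^ m + 2 ^ m                                                     ≡⟨ cong (2 ^ m +_) (+-identityʳ (2 ^ m)) ⟨
  2 ^ suc m                                                         ∎
  where open ≡-Reasoning

single1 : Fin 3 → ∀ m → List (Col m)
single1 c zero = []
single1 c (suc m) = (1F ∷ replicate m c) ∷ map (c ∷_) (single1 c m)

single1-has-1 : ∀ {c m} {x : Col m} → x ∈ single1 c m → Has 1F x
single1-has-1 {c} {suc m} (here refl) = zero , refl
single1-has-1 {c} {suc m} (there x∈) = ∈-prefix (Has 1F) c (λ y∈ → has-∷ (single1-has-1 y∈)) x∈

single1₂-lacks-0 : ∀ {m} {x : Col m} → x ∈ single1 2F m → Lacks 0F x
single1₂-lacks-0 {suc m} (here refl) = lacks-∷ (λ ()) (lacks-replicate 2F (λ ()))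
single1₂-lacks-0 {suc m} (there x∈) = ∈-prefix (Lacks 0F) 2F (λ y∈ → lacks-∷ (λ ()) (single1₂-lacks-0 y∈)) x∈

single1₀-has-0 : ∀ {m} {x : Col (suc (suc m))} → x ∈ single1 0F (suc (suc m)) → Has 0F x
single1₀-has-0 (here refl) = suc zero , refl
single1₀-has-0 (there x∈) = ∈-prefix (Has 0F) 0F (λ _ → zero , refl) x∈

single1-unique : ∀ {c} → c ≢ 1F → ∀ m → Unique (single1 c m)
single1-unique c≢1 zero = []
single1-unique c≢1 (suc m) = ∷-prefix-unique (c≢1 ∘ sym) (single1-unique c≢1 m)

length-single1 : ∀ c m → length (single1 c m) ≡ m
length-single1 c zero = refl
length-single1 c (suc m) = cong suc (trans (length-map _ (single1 c m)) (length-single1 c m))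

onesAt-single1 : ∀ {c} → c ≢ 1F → ∀ {m} (s : Fin m) → onesAt s (single1 c m) ≤ 1
onesAt-single1 {c} c≢1 {suc m} zero = ≤-reflexive (cong suc (onesAt-top (single1 c m) c≢1))
onesAt-single1 {c} c≢1 {suc m} (suc s) = subst (_≤ 1)
  (sym (cong₂ _+_ (𝟙-no (lookup (replicate m c) s Finₚ.≟ 1F) (lacks-replicate c c≢1 s))
                  (onesAt-tail c s (single1 c m))))
  (onesAt-single1 c≢1 s)

occ-single1₂ : ∀ p → HitsBelow1 p → ∀ {m} {r s : Fin m} → r Fin.< s → occ p r s (single1 2F m) ≡ 0
occ-single1₂ p below1 {suc m} {zero} {suc s} _ =
  +≡0 (hits-lacking-1 p below1 1F (lacks-replicate 2F (λ ()) s)) (occ-top-missed p 2F s (single1 2F m) (hits-2F p))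
occ-single1₂ p below1 {suc m} {suc r} {suc s} (s<s r<s) =
  +≡0 (hits-lacking-1 p below1 (lookup (replicate m 2F) r) (lacks-replicate 2F (λ ()) s))
      (trans (occ-tail p 2F r s (single1 2F m)) (occ-single1₂ p below1 r<s))

occ-single1₀ : ∀ {m} {r s : Fin m} → r Fin.< s → occ p11 r s (single1 0F m) ≡ 0
occ-single1₀ {suc m} {zero} {suc s} _ =
  +≡0 (hits-lacking-1 p11 p11-below1 1F (lacks-replicate 0F (λ ()) s))
      (occ-top-missed p11 0F s (single1 0F m) λ _ → refl)
occ-single1₀ {suc m} {suc r} {suc s} (s<s r<s) =
  +≡0 (hits-lacking-1 p11 p11-below1 (lookup (replicate m 0F) r) (lacks-replicate 0F (λ ()) s))
      (trans (occ-tail p11 0F r s (single1 0F m)) (occ-single1₀ r<s))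

oneOverZeros : ∀ m → List (Col m)
oneOverZeros zero = []
oneOverZeros (suc zero) = []
oneOverZeros (suc (suc m)) = (1F ∷ replicate (suc m) 0F) ∷ map (2F ∷_) (oneOverZeros (suc m))

oneOverZeros-has-1 : ∀ {m} {x : Col m} → x ∈ oneOverZeros m → Has 1F x
oneOverZeros-has-1 {suc (suc m)} (here refl) = zero , refl
oneOverZeros-has-1 {suc (suc m)} (there x∈) = ∈-prefix (Has 1F) 2F (λ y∈ → has-∷ (oneOverZeros-has-1 y∈)) x∈

oneOverZeros-has-0 : ∀ {m} {x : Col m} → x ∈ oneOverZeros m → Has 0F x
oneOverZeros-has-0 {suc (suc m)} (here refl) = suc zero , refl
oneOverZeros-has-0 {suc (suc m)} (there x∈) = ∈-prefix (Has 0F) 2F (λ y∈ → has-∷ (oneOverZeros-has-0 y∈)) x∈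

oneOverZeros-unique : ∀ m → Unique (oneOverZeros m)
oneOverZeros-unique zero = []
oneOverZeros-unique (suc zero) = []
oneOverZeros-unique (suc (suc m)) = ∷-prefix-unique (λ ()) (oneOverZeros-unique (suc m))

length-oneOverZeros : ∀ m → length (oneOverZeros (suc m)) ≡ m
length-oneOverZeros zero = refl
length-oneOverZeros (suc m) = cong suc (trans (length-map _ (oneOverZeros (suc m))) (length-oneOverZeros m))

onesAt-oneOverZeros : ∀ {m} (s : Fin m) → onesAt s (oneOverZeros m) ≤ 1
onesAt-oneOverZeros {suc zero} zero = z≤n
onesAt-oneOverZeros {suc (suc m)} zero = ≤-reflexive (cong suc (onesAt-top (oneOverZeros (suc m)) λ ()))
onesAt-oneOverZeros {suc (suc m)} (suc s) = subst (_≤ 1)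
  (sym (cong₂ _+_ (𝟙-no (lookup (replicate (suc m) 0F) s Finₚ.≟ 1F) (lacks-replicate 0F (λ ()) s))
                  (onesAt-tail 2F s (oneOverZeros (suc m)))))
  (onesAt-oneOverZeros s)

occ-oneOverZeros : ∀ {m} {r s : Fin m} → r Fin.< s → occ p01 r s (oneOverZeros m) ≡ 0
occ-oneOverZeros {suc (suc m)} {zero} {suc s} _ = occ-top-missed p01 2F s (oneOverZeros (suc m)) λ _ → refl
occ-oneOverZeros {suc (suc m)} {suc r} {suc s} (s<s r<s) =
  +≡0 (hits-lacking-1 p01 p01-below1 (lookup (replicate (suc m) 0F) r) (lacks-replicate 0F (λ ()) s))
      (trans (occ-tail p01 2F r s (oneOverZeros (suc m))) (occ-oneOverZeros r<s))

length-by-top : ∀ {m} h₁ h₂ h₃ (L₁ L₂ L₃ : List (Col m)) →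
                length (map (h₁ ∷_) L₁ ++ map (h₂ ∷_) L₂ ++ map (h₃ ∷_) L₃) ≡ length L₁ + (length L₂ + length L₃)
length-by-top h₁ h₂ h₃ L₁ L₂ L₃ =
  trans (length-++ (map (h₁ ∷_) L₁))
        (cong₂ _+_ (length-map _ L₁)
                   (trans (length-++ (map (h₂ ∷_) L₂)) (cong₂ _+_ (length-map _ L₂) (length-map _ L₃))))

occ-by-top : ∀ {m} p h₁ h₂ h₃ (r s : Fin (suc m)) L₁ L₂ L₃ →
             occ p r s (map (h₁ ∷_) L₁ ++ map (h₂ ∷_) L₂ ++ map (h₃ ∷_) L₃)
             ≡ occ p r s (map (h₁ ∷_) L₁) + (occ p r s (map (h₂ ∷_) L₂) + occ p r s (map (h₃ ∷_) L₃))
occ-by-top p h₁ h₂ h₃ r s L₁ L₂ L₃ =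
  trans (occ-++ p r s (map (h₁ ∷_) L₁) _) (cong (occ p r s (map (h₁ ∷_) L₁) +_) (occ-++ p r s (map (h₂ ∷_) L₂) _))

occ-by-top-tail : ∀ {m} p h₁ h₂ h₃ (r s : Fin m) L₁ L₂ L₃ →
                  occ p (suc r) (suc s) (map (h₁ ∷_) L₁ ++ map (h₂ ∷_) L₂ ++ map (h₃ ∷_) L₃)
                  ≡ occ p r s L₁ + (occ p r s L₂ + occ p r s L₃)
occ-by-top-tail p h₁ h₂ h₃ r s L₁ L₂ L₃ = trans (occ-by-top p h₁ h₂ h₃ (suc r) (suc s) L₁ L₂ L₃)
  (cong₂ _+_ (occ-tail p h₁ r s L₁) (cong₂ _+_ (occ-tail p h₂ r s L₂) (occ-tail p h₃ r s L₃)))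

-- Matrices built top row first: p only occurs with α on top and 1 below, never under π or 2.
-- T₀ has no occurrence of p, T₁ at most one and T₂ at most two in every pair of rows, X
-- supplying the second occurrences for the pairs that contain the top row.
module Extremal (α π : Fin 3) (p : Pattern) (α≢π : α ≢ π) (α≢2 : α ≢ 2F) (π≢2 : π ≢ 2F)
                (below1 : HitsBelow1 p) (π-misses : ∀ v → hits p (π ∷ v ∷ []) ≡ 0)
                (X : ∀ m → List (Col m)) where

  tails₁ : ∀ m → List (Col m)
  tails₁ m = over02 m ++ single1 2F m

  T₀ T₁ : ∀ m → List (Col m)
  T₀ zero = [] ∷ []
  T₀ (suc m) = map (2F ∷_) (T₀ m) ++ map (π ∷_) (T₀ m) ++ map (α ∷_) (over02 m)
  T₁ zero = [] ∷ []
  T₁ (suc m) = map (2F ∷_) (T₁ m) ++ map (π ∷_) (T₀ m) ++ map (α ∷_) (tails₁ m)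

  T₂ : ∀ m → List (Col (suc m))
  T₂ m = map (2F ∷_) (T₁ m) ++ map (π ∷_) (T₁ m) ++ map (α ∷_) (tails₁ m ++ X m)

  private
    2≢α = α≢2 ∘ sym
    2≢π = π≢2 ∘ sym
    π≢α = α≢π ∘ sym

    has-lacks-disjoint : ∀ {m v} {L L′ : List (Col m)} →
                         (∀ {x} → x ∈ L → Has v x) → (∀ {x} → x ∈ L′ → Lacks v x) → Disjoint L L′
    has-lacks-disjoint has lacks (x∈L , x∈L′) with k , xk≡v ← has x∈L = lacks x∈L′ k xk≡v

  length-tails₁ : ∀ m → length (tails₁ m) ≡ 2 ^ m + m
  length-tails₁ m = trans (length-++ (over02 m)) (cong₂ _+_ (length-over02 m) (length-single1 2F m))

  tails₁-unique : ∀ m → Unique (tails₁ m)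
  tails₁-unique m = Unique.++⁺ (over02-unique m) (single1-unique (λ ()) m)
    (λ (x∈N , x∈E) → has-lacks-disjoint single1-has-1 over02-lacks-1 (x∈E , x∈N))

  onesAt-tails₁ : ∀ {m} (s : Fin m) → onesAt s (tails₁ m) ≤ 1
  onesAt-tails₁ {m} s = begin
    onesAt s (tails₁ m)                           ≡⟨ ∑-++ (over02 m) (single1 2F m) _ ⟩
    onesAt s (over02 m) + onesAt s (single1 2F m) ≡⟨ +≡0-left (onesAt-lacking-1 s over02-lacks-1) refl ⟩
    onesAt s (single1 2F m)                       ≤⟨ onesAt-single1 (λ ()) s ⟩
    1                                             ∎
    where open ≤-Reasoning

  occ-tails₁ : ∀ {m} {r s : Fin m} → r Fin.< s → occ p r s (tails₁ m) ≡ 0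
  occ-tails₁ {m} {r} {s} r<s = trans (occ-++ p r s (over02 m) (single1 2F m))
    (+≡0 (occ-lacking-1 p below1 r s over02-lacks-1) (occ-single1₂ p below1 r<s))

  occ-top-≤ : ∀ {m} (s : Fin m) L₁ L₂ L₃ →
              occ p zero (suc s) (map (2F ∷_) L₁ ++ map (π ∷_) L₂ ++ map (α ∷_) L₃) ≤ onesAt s L₃
  occ-top-≤ s L₁ L₂ L₃ = begin
    occ p zero (suc s) (map (2F ∷_) L₁ ++ map (π ∷_) L₂ ++ map (α ∷_) L₃)
      ≡⟨ occ-by-top p 2F π α zero (suc s) L₁ L₂ L₃ ⟩
    occ p zero (suc s) (map (2F ∷_) L₁) + (occ p zero (suc s) (map (π ∷_) L₂) + occ p zero (suc s) (map (α ∷_) L₃))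
      ≡⟨ +≡0-left (occ-top-missed p 2F s L₁ (hits-2F p))
                  (+≡0-left (occ-top-missed p π s L₂ π-misses) (occ-top p α s L₃)) ⟩
    ∑[ y ∈ L₃ ] hits p (α ∷ lookup y s ∷ [])
      ≤⟨ ∑-mono L₃ (λ {y} _ → below1 α (lookup y s)) ⟩
    onesAt s L₃ ∎
    where open ≤-Reasoning

  length-T₀ : ∀ m → length (T₀ m) ≡ g m
  length-T₀ zero = refl
  length-T₀ (suc m) = begin
    length (T₀ (suc m))                                 ≡⟨ length-by-top 2F π α (T₀ m) (T₀ m) (over02 m) ⟩
    length (T₀ m) + (length (T₀ m) + length (over02 m)) ≡⟨ cong₂ (λ a b → a + (a + b)) (length-T₀ m)
                                                                                      (length-over02 m) ⟩
    g m + (g m + 2 ^ m)                                 ≡⟨ +-assoc (g m) (g m) (2 ^ m) ⟨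
    g (suc m)                                           ∎
    where open ≡-Reasoning

  length-T₁ : ∀ m → length (T₁ m) ≡ g m + m C 2
  length-T₁ zero = refl
  length-T₁ (suc m) = begin
    length (T₁ (suc m))                                 ≡⟨ length-by-top 2F π α (T₁ m) (T₀ m) (tails₁ m) ⟩
    length (T₁ m) + (length (T₀ m) + length (tails₁ m)) ≡⟨ cong₂ _+_ (length-T₁ m)
                                                                     (cong₂ _+_ (length-T₀ m) (length-tails₁ m)) ⟩
    g m + m C 2 + (g m + (2 ^ m + m))                   ≡⟨ regroup (g m) (m C 2) (2 ^ m) m ⟩
    g m + g m + 2 ^ m + (m + m C 2)                     ≡⟨ cong (g (suc m) +_) (suc-C2 m) ⟨
    g (suc m) + suc m C 2                               ∎
    where
    open ≡-Reasoning
    regroup : ∀ G C T m → G + C + (G + (T + m)) ≡ G + G + T + (m + C)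
    regroup = solve-∀

  length-T₂ : ∀ m → length (T₂ m) + m ≡ g (suc m) + 2 * (suc m C 2) + length (X m)
  length-T₂ m = begin
    length (T₂ m) + m
      ≡⟨ cong (_+ m) (length-by-top 2F π α (T₁ m) (T₁ m) (tails₁ m ++ X m)) ⟩
    length (T₁ m) + (length (T₁ m) + length (tails₁ m ++ X m)) + m
      ≡⟨ cong₂ (λ a b → a + (a + b) + m) (length-T₁ m)
               (trans (length-++ (tails₁ m)) (cong (_+ length (X m)) (length-tails₁ m))) ⟩
    g m + m C 2 + (g m + m C 2 + (2 ^ m + m + length (X m))) + m
      ≡⟨ regroup (g m) (m C 2) (2 ^ m) m (length (X m)) ⟩
    g m + g m + 2 ^ m + 2 * (m + m C 2) + length (X m)
      ≡⟨ cong (λ n → g (suc m) + 2 * n + length (X m)) (suc-C2 m) ⟨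
    g (suc m) + 2 * (suc m C 2) + length (X m) ∎
    where
    open ≡-Reasoning
    regroup : ∀ G C T m x → G + C + (G + C + (T + m + x)) + m ≡ G + G + T + 2 * (m + C) + x
    regroup = solve-∀

  T₀-unique : ∀ m → Unique (T₀ m)
  T₀-unique zero = [] ∷ []
  T₀-unique (suc m) = by-top-unique 2≢π 2≢α π≢α (T₀-unique m) (T₀-unique m) (over02-unique m)

  T₁-unique : ∀ m → Unique (T₁ m)
  T₁-unique zero = [] ∷ []
  T₁-unique (suc m) = by-top-unique 2≢π 2≢α π≢α (T₁-unique m) (T₀-unique m) (tails₁-unique m)

  T₂-unique : ∀ m → Unique (X m) → (∀ {x} → x ∈ X m → Has 1F x × Has 0F x) → Unique (T₂ m)
  T₂-unique m X-unique X-has = by-top-unique 2≢π 2≢α π≢α (T₁-unique m) (T₁-unique m)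
    (Unique.++⁺ (tails₁-unique m) X-unique λ (x∈tails , x∈X) →
      [ (λ x∈N → has-lacks-disjoint (proj₁ ∘ X-has) over02-lacks-1 (x∈X , x∈N))
      , (λ x∈E → has-lacks-disjoint (proj₂ ∘ X-has) single1₂-lacks-0 (x∈X , x∈E)) ]′
      (∈-++⁻ (over02 m) x∈tails))

  occ-T₀ : ∀ {m} {r s : Fin m} → r Fin.< s → occ p r s (T₀ m) ≡ 0
  occ-T₀ {suc m} {zero} {suc s} _ =
    n≤0⇒n≡0 (≤-trans (occ-top-≤ s (T₀ m) (T₀ m) (over02 m)) (≤-reflexive (onesAt-lacking-1 s over02-lacks-1)))
  occ-T₀ {suc m} {suc r} {suc s} (s<s r<s) =
    trans (occ-by-top-tail p 2F π α r s (T₀ m) (T₀ m) (over02 m))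
          (+≡0 (occ-T₀ r<s) (+≡0 (occ-T₀ r<s) (occ-lacking-1 p below1 r s over02-lacks-1)))

  occ-T₁ : ∀ {m} {r s : Fin m} → r Fin.< s → occ p r s (T₁ m) ≤ 1
  occ-T₁ {suc m} {zero} {suc s} _ = ≤-trans (occ-top-≤ s (T₁ m) (T₀ m) (tails₁ m)) (onesAt-tails₁ s)
  occ-T₁ {suc m} {suc r} {suc s} (s<s r<s) = begin
    occ p (suc r) (suc s) (T₁ (suc m))
      ≡⟨ occ-by-top-tail p 2F π α r s (T₁ m) (T₀ m) (tails₁ m) ⟩
    occ p r s (T₁ m) + (occ p r s (T₀ m) + occ p r s (tails₁ m))
      ≡⟨ cong (occ p r s (T₁ m) +_) (+≡0 (occ-T₀ r<s) (occ-tails₁ r<s)) ⟩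
    occ p r s (T₁ m) + 0
      ≤⟨ +-monoˡ-≤ 0 (occ-T₁ r<s) ⟩
    1 ∎
    where open ≤-Reasoning

  occ-T₂ : ∀ m → (∀ {r s} → r Fin.< s → occ p r s (X m) ≡ 0) → (∀ s → onesAt s (X m) ≤ 1) →
           ∀ {r s} → r Fin.< s → occ p r s (T₂ m) ≤ 2
  occ-T₂ m occ-X ones-X {zero} {suc s} _ = begin
    occ p zero (suc s) (T₂ m)                   ≤⟨ occ-top-≤ s (T₁ m) (T₁ m) (tails₁ m ++ X m) ⟩
    onesAt s (tails₁ m ++ X m)                  ≡⟨ ∑-++ (tails₁ m) (X m) _ ⟩
    onesAt s (tails₁ m) + onesAt s (X m)        ≤⟨ +-mono-≤ (onesAt-tails₁ s) (ones-X s) ⟩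
    2                                           ∎
    where open ≤-Reasoning
  occ-T₂ m occ-X ones-X {suc r} {suc s} (s<s r<s) = begin
    occ p (suc r) (suc s) (T₂ m)
      ≡⟨ occ-by-top-tail p 2F π α r s (T₁ m) (T₁ m) (tails₁ m ++ X m) ⟩
    occ p r s (T₁ m) + (occ p r s (T₁ m) + occ p r s (tails₁ m ++ X m))
      ≡⟨ cong (λ n → occ p r s (T₁ m) + (occ p r s (T₁ m) + n))
              (trans (occ-++ p r s (tails₁ m) (X m)) (+≡0 (occ-tails₁ r<s) (occ-X r<s))) ⟩
    occ p r s (T₁ m) + (occ p r s (T₁ m) + 0)
      ≤⟨ +-mono-≤ (occ-T₁ r<s) (+-monoˡ-≤ 0 (occ-T₁ r<s)) ⟩
    2 ∎
    where open ≤-Reasoning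

module Avoiding3·I₂ = Extremal 0F 1F p01 (λ ()) (λ ()) (λ ()) p01-below1 (λ _ → refl) oneOverZeros
module Avoiding3·K₂ = Extremal 1F 0F p11 (λ ()) (λ ()) (λ ()) p11-below1 (λ _ → refl) (single1 0F)

occ≤2⇒3·I₂⊀ : ∀ {m} (A : List (Col m)) → (∀ {r s} → r Fin.< s → occ p01 r s A ≤ 2) → ¬ ((3 · I₂) ≺ A)
occ≤2⇒3·I₂⊀ A occ≤2 I≺A with r , s , r≢s , 3≤n₁₀ , 3≤n₀₁ ← 3·I₂≺⇒occ A I≺A with Finₚ.<-cmp r s
... | tri< r<s _ _ = <⇒≱ 3≤n₀₁ (occ≤2 r<s)
... | tri≈ _ r≡s _ = r≢s r≡s
... | tri> _ _ s<r = <⇒≱ 3≤n₁₀ (subst (_≤ 2) (sym (occ-mirror p01 s r A)) (occ≤2 s<r))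

occ≤2⇒3·K₂⊀ : ∀ {m} (A : List (Col m)) → (∀ {r s} → r Fin.< s → occ p11 r s A ≤ 2) → ¬ ((3 · K₂) ≺ A)
occ≤2⇒3·K₂⊀ A occ≤2 K≺A with r , s , r≢s , 3≤n₁₁ ← 3·K₂≺⇒occ A K≺A with Finₚ.<-cmp r s
... | tri< r<s _ _ = <⇒≱ 3≤n₁₁ (occ≤2 r<s)
... | tri≈ _ r≡s _ = r≢s r≡s
... | tri> _ _ s<r = <⇒≱ 3≤n₁₁ (subst (_≤ 2) (sym (occ-mirror p11 s r A)) (occ≤2 s<r))

3·I₂-extremal : ∀ {m} → 2 ≤ m → Σ (Matrix m 3) λ A → Avoid m 3 (3 · I₂) A × suc (length A) ≡ g m + 2 * (m C 2)
3·I₂-extremal {suc zero} (s≤s ())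
3·I₂-extremal {suc (suc m)} _ =
  T₂ (suc m) ,
  (T₂-unique (suc m) (oneOverZeros-unique (suc m)) (λ x∈ → oneOverZeros-has-1 x∈ , oneOverZeros-has-0 x∈) ,
   occ≤2⇒3·I₂⊀ (T₂ (suc m)) (occ-T₂ (suc m) occ-oneOverZeros onesAt-oneOverZeros)) ,
  +-cancelʳ-≡ m _ _ (begin
    suc (length (T₂ (suc m))) + m                     ≡⟨ +-suc (length (T₂ (suc m))) m ⟨
    length (T₂ (suc m)) + suc m                       ≡⟨ length-T₂ (suc m) ⟩
    G + length (oneOverZeros (suc m))                 ≡⟨ cong (G +_) (length-oneOverZeros m) ⟩
    G + m                                             ∎)
  where
  open Avoiding3·I₂
  open ≡-Reasoning
  G = g (suc (suc m)) + 2 * (suc (suc m) C 2)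

3·K₂-extremal : ∀ {m} → 3 ≤ m → Σ (Matrix m 3) λ A → Avoid m 3 (3 · K₂) A × length A ≡ g m + 2 * (m C 2)
3·K₂-extremal {suc zero} (s≤s ())
3·K₂-extremal {suc (suc zero)} (s≤s (s≤s ()))
3·K₂-extremal {suc (suc (suc m))} _ =
  T₂ (suc (suc m)) ,
  (T₂-unique (suc (suc m)) (single1-unique (λ ()) (suc (suc m))) (λ x∈ → single1-has-1 x∈ , single1₀-has-0 x∈) ,
   occ≤2⇒3·K₂⊀ (T₂ (suc (suc m))) (occ-T₂ (suc (suc m)) occ-single1₀ (onesAt-single1 (λ ())))) ,
  +-cancelʳ-≡ (suc (suc m)) _ _
    (trans (length-T₂ (suc (suc m))) (cong (g (suc (suc (suc m))) + 2 * (suc (suc (suc m)) C 2) +_)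
                                            (length-single1 0F (suc (suc m)))))
  where open Avoiding3·K₂

corollary2 : ∀ (a b c d m : ℕ) → b ⊓ c ≡ 3 → a ⊔ d ≤ 2 → m ≥ 4 →
    2 ^ (m ∸ 2) ≥ ((b ⊔ c) ∸ 1) * (m ^ 2) →
    ∃ λ n → IsForb m 3 (Fabcd a b c d) n × IsForb m 3 (3 · I₂) n × IsForb m 3 (3 · K₂) (suc n)
corollary2 a b c d m b⊓c≡3 a⊔d≤2 m≥4 2^≥
  with AI , AI-avoids@(AI-simple , I⊀AI) , |AI|+1≡G ← 3·I₂-extremal (≤-trans (n≤1+n 2) (≤-trans (n≤1+n 3) m≥4))
  with AK , AK-avoids , |AK|≡G ← 3·K₂-extremal (≤-trans (n≤1+n 3) m≥4)
  = length AI
  , ((AI , (AI-simple , F⊀ {AI} I⊀AI) , refl) , λ A (simple , F⊀A) → F-bound A simple F⊀A)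
  , ((AI , AI-avoids , refl) , λ A (simple , I⊀A) → F-bound A simple (F⊀ {A} I⊀A))
  , ((AK , AK-avoids , trans |AK|≡G (sym |AI|+1≡G)) ,
     λ A (simple , K⊀A) → subst (length A ≤_) (sym |AI|+1≡G) (3·K₂-bound A simple K⊀A))
  where
  F⊀ : ∀ {A : Matrix m 3} → ¬ ((3 · I₂) ≺ A) → ¬ (Fabcd a b c d ≺ A)
  F⊀ {A} I⊀A = I⊀A ∘ Fabcd≺⇒3·I₂≺ {a = a} {d = d} {A = A} (subst (_≤ b) b⊓c≡3 (m⊓n≤m b c))
                                                           (subst (_≤ c) b⊓c≡3 (m⊓n≤n b c))
  β-small : (b ⊔ c ∸ 1) * (m * m) ≤ 2 ^ (m ∸ 2)
  β-small = subst (λ k → (b ⊔ c ∸ 1) * k ≤ 2 ^ (m ∸ 2)) (cong (m *_) (*-identityʳ m)) 2^≥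
  F-bound : ∀ (A : Matrix m 3) → Unique A → ¬ (Fabcd a b c d ≺ A) → length A ≤ length AI
  F-bound A simple F⊀A = ≤-pred (subst (length A <_) (sym |AI|+1≡G)
    (Fabcd-bound {a} {b} {c} {d} b⊓c≡3 a⊔d≤2 A (≤-trans (n≤1+n 2) (≤-trans (n≤1+n 3) m≥4)) β-small simple F⊀A))
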